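{- Let $p=3$, $\alpha\in\mathbb Z_3^\times$ and $\beta\in\mathbb Z_3$ with $v(\beta)=1$. If $\alpha\equiv1\pmod3$, then $$v\bigl(t_k^0(\alpha,\beta)\bigr)=\begin{cases}1 & 3\nmid k,\\ \min\{2v(2\beta-2\alpha^2-2\alpha+1)-1,\,2v(2\alpha+1)\}+2v(k) & 3\mid k.\end{cases}$$ If $\alpha\equiv2\pmod3$, then $$v\bigl(t_k^0(\alpha,\beta)\bigr)=\begin{cases}0 & 2\nmid k,\\ 1 & \gcd(k,6)=2,\\ \min\{2v(2\beta-2\alpha^2+2\alpha+1)-1,\,2v(2\alpha-1)\}+2v(k) & 6\mid k.\end{cases}$$
   Context: $v$ is the $3$-adic valuation. For $\mu=0$: $r_k^0(\alpha,x)=\sum_{i=0}^{\lfloor k/2\rfloor}\binom{k}{2i}\alpha^{k-2i}x^i$, $s_k^0(\alpha,x)=\sum_{i=0}^{\lfloor (k-1)/2\rfloor}\binom{k}{2i+1}\alpha^{k-2i-1}x^i$, and $t_k^0(\alpha,x)=(r_k^0(\alpha,x)-1)^2-x\,s_k^0(\alpha,x)^2$, which is $\det(g^k-1)$ for $g=\begin{pmatrix}\alpha&x\\1&\alpha\end{pmatrix}$. -}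

module Defs where

open import Data.Nat as ℕ using (ℕ; zero; suc)
import Data.Nat.Divisibility as ℕD
open import Data.Nat.Combinatorics using (_C_)
open import Data.Integer as ℤ using (ℤ; +_)
open import Data.Integer.Divisibility.Signed using (_∣_; ∣m∣n⇒∣m+n; ∣m⇒∣-m; ∣n⇒∣m*n; ∣m⇒∣m*n; divides)
open import Data.Integer.Tactic.RingSolver using (solve-∀)
open import Data.Maybe using (Maybe; just; nothing)
open import Relation.Binary.PropositionalEquality using (_≡_; refl; subst; sym)
open import Relation.Nullary using (¬_)

-- The 3-adic integers ℤ₃, modelled as coherent sequences of integer
-- approximations: approx n is x modulo 3^n, and
-- approx (n+1) ≡ approx n (mod 3^n).

pow3 : ℕ → ℤ
pow3 n = + (3 ℕ.^ n)

record ℤ₃ : Set where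
  constructor mkℤ₃
  field
    approx : ℕ → ℤ
    coh    : ∀ n → pow3 n ∣ (approx (suc n) ℤ.- approx n)
open ℤ₃ public

private
  add-id : ∀ a b c d → (a ℤ.+ b) ℤ.- (c ℤ.+ d) ≡ (a ℤ.- c) ℤ.+ (b ℤ.- d)
  add-id = solve-∀
  neg-id : ∀ a c → (ℤ.- a) ℤ.- (ℤ.- c) ≡ ℤ.- (a ℤ.- c)
  neg-id = solve-∀
  mul-id : ∀ a b c d → (a ℤ.* b) ℤ.- (c ℤ.* d) ≡ a ℤ.* (b ℤ.- d) ℤ.+ (a ℤ.- c) ℤ.* d
  mul-id = solve-∀
  const-id : ∀ a → a ℤ.- a ≡ + 0
  const-id = solve-∀

infixl 6 _+₃_ _-₃_
infixl 7 _*₃_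
infixr 8 _^₃_

ι : ℤ → ℤ₃
ι a = mkℤ₃ (λ _ → a) (λ n → subst (pow3 n ∣_) (sym (const-id a)) (divides (+ 0) refl))

_+₃_ : ℤ₃ → ℤ₃ → ℤ₃
x +₃ y = mkℤ₃ (λ n → approx x n ℤ.+ approx y n)
  (λ n → subst (pow3 n ∣_) (sym (add-id (approx x (suc n)) (approx y (suc n)) (approx x n) (approx y n)))
           (∣m∣n⇒∣m+n (coh x n) (coh y n)))

-₃_ : ℤ₃ → ℤ₃
-₃ x = mkℤ₃ (λ n → ℤ.- approx x n)
  (λ n → subst (pow3 n ∣_) (sym (neg-id (approx x (suc n)) (approx x n))) (∣m⇒∣-m (coh x n)))

_-₃_ : ℤ₃ → ℤ₃ → ℤ₃
x -₃ y = x +₃ (-₃ y)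

_*₃_ : ℤ₃ → ℤ₃ → ℤ₃
x *₃ y = mkℤ₃ (λ n → approx x n ℤ.* approx y n)
  (λ n → subst (pow3 n ∣_) (sym (mul-id (approx x (suc n)) (approx y (suc n)) (approx x n) (approx y n)))
           (∣m∣n⇒∣m+n (∣n⇒∣m*n (approx x (suc n)) (coh y n)) (∣m⇒∣m*n (approx y n) (coh x n))))

_^₃_ : ℤ₃ → ℕ → ℤ₃
x ^₃ zero  = ι (+ 1)
x ^₃ suc n = x *₃ (x ^₃ n)

sum₃ : ℕ → (ℕ → ℤ₃) → ℤ₃
sum₃ zero    f = f 0
sum₃ (suc m) f = sum₃ m f +₃ f (suc m)

_≡₃_[mod3^_] : ℤ₃ → ℤ₃ → ℕ → Set
x ≡₃ y [mod3^ m ] = pow3 m ∣ (approx x m ℤ.- approx y m)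

-- extended naturals ℕ ∪ {∞}; nothing = ∞
ℕ∞ : Set
ℕ∞ = Maybe ℕ

Val : ℤ₃ → ℕ∞ → Set
Val x (just m) = (x ≡₃ ι (+ 0) [mod3^ m ]) × ¬ (x ≡₃ ι (+ 0) [mod3^ suc m ])
  where open import Data.Product using (_×_)
Val x nothing  = ∀ m → x ≡₃ ι (+ 0) [mod3^ m ]

Val3ℕ : ℕ → ℕ → Set
Val3ℕ k e = (3 ℕ.^ e ℕD.∣ k) × ¬ (3 ℕ.^ suc e ℕD.∣ k)
  where open import Data.Product using (_×_)

min∞ : ℕ∞ → ℕ∞ → ℕ∞
min∞ nothing  w        = w
min∞ (just m) nothing  = just m
min∞ (just m) (just n) = just (m ℕ.⊓ n)

_+∞_ : ℕ∞ → ℕ → ℕ∞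
nothing  +∞ e = nothing
just m   +∞ e = just (m ℕ.+ e)

twiceMinusOne : ℕ∞ → ℕ∞
twiceMinusOne nothing  = nothing
twiceMinusOne (just m) = just (2 ℕ.* m ℕ.∸ 1)

twice : ℕ∞ → ℕ∞
twice nothing  = nothing
twice (just m) = just (2 ℕ.* m)

nat₃ : ℕ → ℤ₃
nat₃ n = ι (+ n)

r0 : ℕ → ℤ₃ → ℤ₃ → ℤ₃
r0 k α x = sum₃ (k ℕ./ 2) (λ i → nat₃ (k C (2 ℕ.* i)) *₃ α ^₃ (k ℕ.∸ 2 ℕ.* i) *₃ x ^₃ i)

-- for k = 0 the sum over i ≤ ⌊(k-1)/2⌋ is empty
s0 : ℕ → ℤ₃ → ℤ₃ → ℤ₃
s0 zero    α x = nat₃ 0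
s0 (suc j) α x = sum₃ (j ℕ./ 2)
  (λ i → nat₃ (suc j C (2 ℕ.* i ℕ.+ 1)) *₃ α ^₃ (suc j ℕ.∸ 2 ℕ.* i ℕ.∸ 1) *₃ x ^₃ i)

t0 : ℕ → ℤ₃ → ℤ₃ → ℤ₃
t0 k α x = (r0 k α x -₃ nat₃ 1) ^₃ 2 -₃ x *₃ (s0 k α x) ^₃ 2

-- Put λ = α + √β. Then t_k = N(λ^k − 1) for the norm N of ℤ₃[√β], which is multiplicative, and since
-- v(β) = 1, √β is a uniformiser above 3. Let α ≡ 1 (mod 3). Then N(λ − 1) = (α − 1)² − β has valuation 1,
-- and λ^k − 1 = (λ − 1)(1 + λ + ⋯ + λ^(k−1)) where the geometric sum is ≡ k modulo √β, a unit when 3 ∤ k.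
-- For k = 3^e m with e ≥ 1 and 3 ∤ m, peel off λ³ − 1 = (λ − 1)(λ² + λ + 1), where
-- 4 N(λ² + λ + 1) = c² + 3d² (c = 2β − 2α² − 2α + 1, d = 2α + 1) has valuation min(2v(c), 2v(d) + 1);
-- each further cubing x ↦ x³ of an x ≡ 1 (mod 3) multiplies N(x − 1) by N(x² + x + 1) = 9·unit,
-- and the remaining geometric sum in λ^(3^e) is a unit again. If α ≡ 2 (mod 3), then t_k is even in α for
-- even k, which reduces to the first case, while for odd k, λ^k − 1 ≡ −2 modulo √β is a unit.
-- Valuations in ℤ₃ are read off from the integer approximations of α and β at high enough precision.

module Submission where

open import Defs
open import Data.Integer using (ℤ)

module NatFacts where

  open import Data.Nat using (ℕ; zero; suc; _≤_; _<_; _+_; _*_; _∸_; _^_; _⊓_)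
  import Data.Nat.Properties as ℕₚ
  open import Data.Nat.Divisibility using (_∣_; divides; ∣m∣n⇒∣m+n; *-monoˡ-∣)
  open import Data.Nat.DivMod using (_/_; m*n/n≡m; /-monoˡ-≤)
  open import Data.Nat.Tactic.RingSolver using (solve-∀)
  open import Data.Maybe using (just; nothing)
  open import Data.Product using (Σ; _×_; _,_)
  open import Data.Empty using (⊥-elim)
  open import Relation.Nullary using (¬_)
  open import Relation.Binary.PropositionalEquality
  open ≡-Reasoning

  half<⇒< : ∀ j i → j / 2 < i → j < 2 * i
  half<⇒< j i j/2<i = ℕₚ.≰⇒> λ 2i≤j → ℕₚ.<⇒≱ j/2<i
    (subst (_≤ j / 2) (m*n/n≡m i 2) (/-monoˡ-≤ 2 (subst (_≤ j) (ℕₚ.*-comm 2 i) 2i≤j)))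

  ¬2∣⇒odd : ∀ k → ¬ 2 ∣ k → Σ ℕ λ j → k ≡ suc (2 * j)
  ¬2∣⇒odd zero          2∤0 = ⊥-elim (2∤0 (divides 0 refl))
  ¬2∣⇒odd (suc zero)    _   = 0 , refl
  ¬2∣⇒odd (suc (suc k)) 2∤k+2 with ¬2∣⇒odd k (λ 2∣k → 2∤k+2 (∣m∣n⇒∣m+n (divides 1 refl) 2∣k))
  ... | j , refl = suc j , cong (λ n → suc (suc n)) (sym (ℕₚ.+-suc j (j + 0)))

  Val3ℕ⇒ : ∀ {k e} → Val3ℕ k e → Σ ℕ λ m → k ≡ 3 ^ e * m × ¬ 3 ∣ m
  Val3ℕ⇒ {e = e} (divides m k≡m3ᵉ , 3ᵉ⁺¹∤k) =
    m , trans k≡m3ᵉ (ℕₚ.*-comm m (3 ^ e)) ,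
    λ 3∣m → 3ᵉ⁺¹∤k (subst (_ ∣_) (sym k≡m3ᵉ) (*-monoˡ-∣ (3 ^ e) 3∣m))

  private
    odd-shift : ∀ n e → 2 * n + 1 + suc (2 * e) ≡ 2 * n + 2 * suc e
    odd-shift = solve-∀

    even-shift : ∀ m e → 2 * suc m + suc (2 * e) ≡ 2 * suc m ∸ 1 + 2 * suc e
    even-shift m e = trans (identity m e) (cong (λ n → n ∸ 1 + 2 * suc e) (sym (ℕₚ.*-suc 2 m)))
      where
      identity : ∀ m e → 2 * suc m + suc (2 * e) ≡ suc (2 * m) + 2 * suc e
      identity = solve-∀

  min∞-shift : ∀ {a} b e → a ≢ just 0 →
    min∞ (twice a) (twice b +∞ 1) +∞ suc (2 * e) ≡ min∞ (twiceMinusOne a) (twice b) +∞ (2 * suc e)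
  min∞-shift {nothing}       nothing  e _   = refl
  min∞-shift {nothing}       (just n) e _   = cong just (odd-shift n e)
  min∞-shift {just zero}     b        e a≢0 = ⊥-elim (a≢0 refl)
  min∞-shift {just (suc m)}  nothing  e _   = cong just (even-shift m e)
  min∞-shift {just (suc m)}  (just n) e _   = cong just (begin
    2 * suc m ⊓ (2 * n + 1) + suc (2 * e)
      ≡⟨ ℕₚ.+-distribʳ-⊓ (suc (2 * e)) (2 * suc m) (2 * n + 1) ⟩
    (2 * suc m + suc (2 * e)) ⊓ (2 * n + 1 + suc (2 * e))
      ≡⟨ cong₂ _⊓_ (even-shift m e) (odd-shift n e) ⟩
    (2 * suc m ∸ 1 + 2 * suc e) ⊓ (2 * n + 2 * suc e)
      ≡⟨ ℕₚ.+-distribʳ-⊓ (2 * suc e) (2 * suc m ∸ 1) (2 * n) ⟨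
    (2 * suc m ∸ 1) ⊓ (2 * n) + 2 * suc e
      ∎)

module FiniteSums where

  open import Data.Nat as ℕ using (ℕ; zero; suc; _≤_; _<_)
  import Data.Nat.Properties as ℕₚ
  open import Data.Integer using (ℤ; +_; _+_; _*_)
  import Data.Integer.Properties as ℤₚ
  open import Data.Integer.Tactic.RingSolver using (solve-∀)
  open import Relation.Binary.PropositionalEquality

  private variable
    n : ℕ
    f g : ℕ → ℤ

  Σ≤ : ℕ → (ℕ → ℤ) → ℤ
  Σ≤ zero    f = f 0
  Σ≤ (suc n) f = Σ≤ n f + f (suc n)

  Σ≤-cong : ∀ n → (∀ i → f i ≡ g i) → Σ≤ n f ≡ Σ≤ n g
  Σ≤-cong zero    f≡g = f≡g 0
  Σ≤-cong (suc n) f≡g = cong₂ _+_ (Σ≤-cong n f≡g) (f≡g (suc n))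

  Σ≤-+ : ∀ n f g → Σ≤ n (λ i → f i + g i) ≡ Σ≤ n f + Σ≤ n g
  Σ≤-+ zero    f g = refl
  Σ≤-+ (suc n) f g = trans (cong (_+ (f (suc n) + g (suc n))) (Σ≤-+ n f g))
                           (interchange (Σ≤ n f) (Σ≤ n g) (f (suc n)) (g (suc n)))
    where
    interchange : ∀ a b c d → (a + b) + (c + d) ≡ (a + c) + (b + d)
    interchange = solve-∀

  Σ≤-*ˡ : ∀ n a f → Σ≤ n (λ i → a * f i) ≡ a * Σ≤ n f
  Σ≤-*ˡ zero    a f = refl
  Σ≤-*ˡ (suc n) a f = trans (cong (_+ a * f (suc n)) (Σ≤-*ˡ n a f))
                            (sym (ℤₚ.*-distribˡ-+ a (Σ≤ n f) (f (suc n))))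

  Σ≤-shift : ∀ n f → Σ≤ (suc n) f ≡ f 0 + Σ≤ n (λ i → f (suc i))
  Σ≤-shift zero    f = refl
  Σ≤-shift (suc n) f = trans (cong (_+ f (suc (suc n))) (Σ≤-shift n f)) (ℤₚ.+-assoc (f 0) _ _)

  Σ≤-extend : ∀ f {m n} → m ≤ n → (∀ i → m < i → f i ≡ + 0) → Σ≤ m f ≡ Σ≤ n f
  Σ≤-extend f {m} m≤n tail≡0 = go (ℕₚ.≤⇒≤′ m≤n)
    where
    go : ∀ {n} → m ℕ.≤′ n → Σ≤ m f ≡ Σ≤ n f
    go ℕ.≤′-refl = refl
    go (ℕ.≤′-step {n} m≤′n) = trans (go m≤′n)
      (trans (sym (ℤₚ.+-identityʳ (Σ≤ n f)))
             (cong (λ z → Σ≤ n f + z) (sym (tail≡0 (suc n) (ℕ.s≤s (ℕₚ.≤′⇒≤ m≤′n))))))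

module Valuation where

  open import Data.Nat as ℕ using (ℕ; zero; suc; _≤_)
  import Data.Nat.Properties as ℕₚ
  import Data.Nat.Divisibility as ℕ∣
  open import Data.Nat.Primality using (prime?; euclidsLemma)
  open import Data.Integer using (ℤ; +_; _+_; _-_; -_; _*_; ∣_∣)
  import Data.Integer.Properties as ℤₚ
  import Data.Integer.Divisibility.Signed as ℤ∣
  open import Data.Integer.Tactic.RingSolver using (solve-∀)
  open import Data.Sum using (_⊎_; inj₁; inj₂)
  open import Relation.Nullary using (¬_)
  open import Data.Empty using (⊥-elim)
  open import Relation.Nullary.Decidable using (from-yes)
  open import Relation.Binary.PropositionalEquality

  infix 4 3^_∣_ 3^_∥_

  record 3^_∣_ (n : ℕ) (x : ℤ) : Set where
    constructor mk∣
    field pow3∣ : pow3 n ℤ∣.∣ x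
  open 3^_∣_ public

  private variable
    m n : ℕ
    u x y : ℤ

  pow3-+ : ∀ m n → pow3 (m ℕ.+ n) ≡ pow3 m * pow3 n
  pow3-+ m n = trans (cong +_ (ℕₚ.^-distribˡ-+-* 3 m n)) (ℤₚ.pos-* (3 ℕ.^ m) (3 ℕ.^ n))

  3^0∣ : ∀ x → 3^ 0 ∣ x
  3^0∣ x = mk∣ (ℤ∣.divides x (sym (ℤₚ.*-identityʳ x)))

  3^n∣0 : ∀ n → 3^ n ∣ + 0
  3^n∣0 n = mk∣ (ℤ∣.divides (+ 0) refl)

  3∣3 : 3^ 1 ∣ + 3
  3∣3 = mk∣ (ℤ∣.divides (+ 1) refl)

  ∣-weaken : m ≤ n → 3^ n ∣ x → 3^ m ∣ x
  ∣-weaken {m} {n} m≤n (mk∣ d) = mk∣ (ℤ∣.∣-trans pow3-m∣n d)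
    where
    pow3-m∣n : pow3 m ℤ∣.∣ pow3 n
    pow3-m∣n = ℤ∣.divides (pow3 (n ℕ.∸ m))
      (trans (cong pow3 (sym (ℕₚ.m∸n+n≡m m≤n))) (pow3-+ (n ℕ.∸ m) m))

  ∣-+ : 3^ n ∣ x → 3^ n ∣ y → 3^ n ∣ x + y
  ∣-+ (mk∣ d) (mk∣ e) = mk∣ (ℤ∣.∣m∣n⇒∣m+n d e)

  ∣-neg : 3^ n ∣ x → 3^ n ∣ - x
  ∣-neg (mk∣ d) = mk∣ (ℤ∣.∣m⇒∣-m d)

  ∣-- : 3^ n ∣ x → 3^ n ∣ y → 3^ n ∣ x - y
  ∣-- d e = ∣-+ d (∣-neg e)

  ∣-*ˡ : ∀ a → 3^ n ∣ x → 3^ n ∣ a * x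
  ∣-*ˡ a (mk∣ d) = mk∣ (ℤ∣.∣n⇒∣m*n a d)

  ∣-*ʳ : ∀ a → 3^ n ∣ x → 3^ n ∣ x * a
  ∣-*ʳ a (mk∣ d) = mk∣ (ℤ∣.∣m⇒∣m*n a d)

  3^n∣3^n : ∀ n → 3^ n ∣ pow3 n
  3^n∣3^n n = mk∣ (ℤ∣.divides (+ 1) (sym (ℤₚ.*-identityˡ (pow3 n))))

  ∣-* : 3^ m ∣ x → 3^ n ∣ y → 3^ (m ℕ.+ n) ∣ x * y
  ∣-* {m} {n = n} (mk∣ (ℤ∣.divides q refl)) (mk∣ (ℤ∣.divides r refl)) =
    mk∣ (ℤ∣.divides (q * r) (trans (regroup q r (pow3 m) (pow3 n)) (cong ((q * r) *_) (sym (pow3-+ m n)))))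
    where
    regroup : ∀ q r a b → (q * a) * (r * b) ≡ (q * r) * (a * b)
    regroup = solve-∀

  ∣-cancel-pow3 : ∀ m n → 3^ (m ℕ.+ n) ∣ y * pow3 n → 3^ m ∣ y
  ∣-cancel-pow3 {y} m n (mk∣ (ℤ∣.divides q eq)) =
    mk∣ (ℤ∣.divides q (ℤₚ.*-cancelʳ-≡ y (q * pow3 m) (pow3 n) {{ℕₚ.m^n≢0 3 n}}
      (trans eq (trans (cong (q *_) (pow3-+ m n)) (sym (ℤₚ.*-assoc q (pow3 m) (pow3 n)))))))

  3∣-euclid : 3^ 1 ∣ x * y → 3^ 1 ∣ x ⊎ 3^ 1 ∣ y
  3∣-euclid {x} {y} (mk∣ d)
    with euclidsLemma ∣ x ∣ ∣ y ∣ (from-yes (prime? 3)) (subst (3 ℕ∣.∣_) (ℤₚ.abs-* x y) (ℤ∣.∣⇒∣ᵤ d))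
  ... | inj₁ 3∣x = inj₁ (mk∣ (ℤ∣.∣ᵤ⇒∣ 3∣x))
  ... | inj₂ 3∣y = inj₂ (mk∣ (ℤ∣.∣ᵤ⇒∣ 3∣y))

  3∤-* : ¬ 3^ 1 ∣ x → ¬ 3^ 1 ∣ y → ¬ 3^ 1 ∣ x * y
  3∤-* 3∤x 3∤y 3∣xy with 3∣-euclid 3∣xy
  ... | inj₁ 3∣x = 3∤x 3∣x
  ... | inj₂ 3∣y = 3∤y 3∣y

  3∤-+ : ¬ 3^ 1 ∣ u → 3^ 1 ∣ y → ¬ 3^ 1 ∣ u + y
  3∤-+ {u} {y} 3∤u 3∣y 3∣u+y = 3∤u (subst (3^ 1 ∣_) (cancel u y) (∣-- 3∣u+y 3∣y))
    where
    cancel : ∀ u y → (u + y) - y ≡ u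
    cancel = solve-∀

  3∤1 : ¬ 3^ 1 ∣ + 1
  3∤1 (mk∣ d) with ℕ∣.∣⇒≤ (ℤ∣.∣⇒∣ᵤ d)
  ... | ℕ.s≤s ()

  3∤2 : ¬ 3^ 1 ∣ + 2
  3∤2 (mk∣ d) with ℕ∣.∣⇒≤ (ℤ∣.∣⇒∣ᵤ d)
  ... | ℕ.s≤s (ℕ.s≤s ())

  ∣-cancelˡ : ¬ 3^ 1 ∣ u → 3^ n ∣ u * x → 3^ n ∣ x
  ∣-cancelˡ {n = zero} {x} _ _ = 3^0∣ x
  ∣-cancelˡ {u} {suc n} 3∤u 3ⁿ⁺¹∣ux with ∣-cancelˡ 3∤u (∣-weaken (ℕₚ.n≤1+n n) 3ⁿ⁺¹∣ux)
  ... | mk∣ (ℤ∣.divides y refl)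
    with 3∣-euclid (∣-cancel-pow3 1 n (subst (3^ suc n ∣_) (sym (ℤₚ.*-assoc u y (pow3 n))) 3ⁿ⁺¹∣ux))
  ...   | inj₁ 3∣u = ⊥-elim (3∤u 3∣u)
  ...   | inj₂ 3∣y = ∣-* 3∣y (3^n∣3^n n)

  record 3^_∥_ (n : ℕ) (x : ℤ) : Set where
    constructor mk∥
    field
      unit          : ℤ
      3∤unit        : ¬ 3^ 1 ∣ unit
      factorisation : x ≡ unit * pow3 n

  ∥⇒∣ : 3^ n ∥ x → 3^ n ∣ x
  ∥⇒∣ (mk∥ u _ eq) = mk∣ (ℤ∣.divides u eq)

  ∥⇒∤ : 3^ n ∥ x → ¬ 3^ suc n ∣ x
  ∥⇒∤ {n} (mk∥ u 3∤u refl) 3ⁿ⁺¹∣x = 3∤u (∣-cancel-pow3 1 n 3ⁿ⁺¹∣x)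

  ∣∧∤⇒∥ : 3^ n ∣ x → ¬ 3^ suc n ∣ x → 3^ n ∥ x
  ∣∧∤⇒∥ {n} (mk∣ (ℤ∣.divides q refl)) 3ⁿ⁺¹∤x =
    mk∥ q (λ 3∣q → 3ⁿ⁺¹∤x (∣-* 3∣q (3^n∣3^n n))) refl

  3∤⇒∥0 : ¬ 3^ 1 ∣ u → 3^ 0 ∥ u
  3∤⇒∥0 {u} 3∤u = mk∥ u 3∤u (sym (ℤₚ.*-identityʳ u))

  3∥3 : 3^ 1 ∥ + 3
  3∥3 = mk∥ (+ 1) 3∤1 refl

  ∥-* : 3^ m ∥ x → 3^ n ∥ y → 3^ (m ℕ.+ n) ∥ x * y
  ∥-* {m} {n = n} (mk∥ u 3∤u refl) (mk∥ v 3∤v refl) =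
    mk∥ (u * v) (3∤-* 3∤u 3∤v) (trans (regroup u v (pow3 m) (pow3 n)) (cong ((u * v) *_) (sym (pow3-+ m n))))
    where
    regroup : ∀ u v a b → (u * a) * (v * b) ≡ (u * v) * (a * b)
    regroup = solve-∀

  ∥-neg : 3^ n ∥ x → 3^ n ∥ - x
  ∥-neg {n} (mk∥ u 3∤u refl) =
    mk∥ (- u) (λ 3∣-u → 3∤u (subst (3^ 1 ∣_) (ℤₚ.neg-involutive u) (∣-neg 3∣-u)))
      (ℤₚ.neg-distribˡ-* u (pow3 n))

  ∥-+ : 3^ n ∥ x → 3^ suc n ∣ y → 3^ n ∥ x + y
  ∥-+ {n} {x} {y} x∥ 3ⁿ⁺¹∣y = ∣∧∤⇒∥ (∣-+ (∥⇒∣ x∥) (∣-weaken (ℕₚ.n≤1+n n) 3ⁿ⁺¹∣y))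
    (λ 3ⁿ⁺¹∣x+y → ∥⇒∤ x∥ (subst (3^ suc n ∣_) (cancel x y) (∣-- 3ⁿ⁺¹∣x+y 3ⁿ⁺¹∣y)))
    where
    cancel : ∀ x y → (x + y) - y ≡ x
    cancel = solve-∀

  ∣-+∥ : 3^ suc n ∣ x → 3^ n ∥ y → 3^ n ∥ x + y
  ∣-+∥ {x = x} {y} 3ⁿ⁺¹∣x y∥ = subst (3^ _ ∥_) (ℤₚ.+-comm y x) (∥-+ y∥ 3ⁿ⁺¹∣x)

  ∣-∥ : 3^ suc n ∣ x → 3^ n ∥ y → 3^ n ∥ x - y
  ∣-∥ 3ⁿ⁺¹∣x y∥ = ∣-+∥ 3ⁿ⁺¹∣x (∥-neg y∥)

  ∥-cancelˡ : ¬ 3^ 1 ∣ u → 3^ n ∥ u * x → 3^ n ∥ x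
  ∥-cancelˡ {u} 3∤u ux∥ =
    ∣∧∤⇒∥ (∣-cancelˡ 3∤u (∥⇒∣ ux∥)) (λ 3ⁿ⁺¹∣x → ∥⇒∤ ux∥ (∣-*ˡ u 3ⁿ⁺¹∣x))

  ∥-sq+3sq-even : 3^ m ∥ x → 3^ m ∣ y → 3^ (m ℕ.+ m) ∥ x * x + + 3 * (y * y)
  ∥-sq+3sq-even x∥ 3ᵐ∣y = ∥-+ (∥-* x∥ x∥) (∣-* 3∣3 (∣-* 3ᵐ∣y 3ᵐ∣y))

  ∥-sq+3sq-odd : 3^ suc n ∣ x → 3^ n ∥ y → 3^ suc (n ℕ.+ n) ∥ x * x + + 3 * (y * y)
  ∥-sq+3sq-odd {n} 3ⁿ⁺¹∣x y∥ =
    ∣-+∥ (∣-weaken (ℕ.s≤s (ℕₚ.≤-reflexive (sym (ℕₚ.+-suc n n)))) (∣-* 3ⁿ⁺¹∣x 3ⁿ⁺¹∣x))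
         (∥-* 3∥3 (∥-* y∥ y∥))

  ∣-sq+3sq : 3^ m ∣ x → 3^ m ∣ y → 3^ (m ℕ.+ m) ∣ x * x + + 3 * (y * y)
  ∣-sq+3sq {m} 3ᵐ∣x 3ᵐ∣y =
    ∣-+ (∣-* 3ᵐ∣x 3ᵐ∣x) (∣-weaken (ℕₚ.n≤1+n (m ℕ.+ m)) (∣-* 3∣3 (∣-* 3ᵐ∣y 3ᵐ∣y)))

module ThreeAdicValuation where

  open Valuation
  open import Data.Nat as ℕ using (ℕ; suc; _≤_; _<_; _≤′_; ≤′-refl; ≤′-step)
  import Data.Nat.Properties as ℕₚ
  open import Data.Integer using (ℤ; +_; _+_; _-_; -_; _*_)
  import Data.Integer.Properties as ℤₚ
  import Data.Integer.Divisibility.Signed as ℤ∣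
  open import Data.Integer.Tactic.RingSolver using (solve-∀)
  open import Data.Maybe using (just; nothing)
  open import Data.Product using (Σ; _×_; _,_)
  open import Relation.Nullary using (¬_; yes; no)
  open import Relation.Binary.PropositionalEquality

  private variable
    i j m n N : ℕ
    w : ℕ∞

  infix 4 _≈₃_

  _≈₃_ : ℤ₃ → ℤ₃ → Set
  x ≈₃ y = ∀ n → approx x n ≡ approx y n

  private
    telescope : ∀ a b c → (a - b) + (b - c) ≡ a - c
    telescope = solve-∀

  approx-coh : ∀ x → i ≤′ j → 3^ i ∣ approx x j - approx x i
  approx-coh {i} x ≤′-refl = subst (3^ i ∣_) (sym (ℤₚ.+-inverseʳ (approx x i))) (3^n∣0 i)
  approx-coh {i} x (≤′-step {j} i≤′j) =
    subst (3^ i ∣_) (telescope (approx x (suc j)) (approx x j) (approx x i))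
      (∣-+ (∣-weaken (ℕₚ.≤′⇒≤ i≤′j) (mk∣ (coh x j))) (approx-coh x i≤′j))

  ≡₃-lift : ∀ x c → x ≡₃ ι c [mod3^ i ] → i ≤ N → 3^ i ∣ approx x N - c
  ≡₃-lift {i} {N} x c x≡c i≤N =
    subst (3^ i ∣_) (telescope (approx x N) (approx x i) c)
      (∣-+ (approx-coh x (ℕₚ.≤⇒≤′ i≤N)) (mk∣ x≡c))

  ≡₃0⇒∣ : ∀ x → x ≡₃ ι (+ 0) [mod3^ i ] → i ≤ N → 3^ i ∣ approx x N
  ≡₃0⇒∣ {N = N} x x≡0 i≤N = subst (3^ _ ∣_) (ℤₚ.+-identityʳ (approx x N)) (≡₃-lift x (+ 0) x≡0 i≤N)

  ∣⇒≡₃0 : ∀ x → 3^ i ∣ approx x N → i ≤ N → x ≡₃ ι (+ 0) [mod3^ i ]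
  ∣⇒≡₃0 {i} {N} x 3ⁱ∣xN i≤N =
    pow3∣ (subst (3^ i ∣_) (step (approx x N) (approx x i)) (∣-- 3ⁱ∣xN (approx-coh x (ℕₚ.≤⇒≤′ i≤N))))
    where
    step : ∀ a b → a - (a - b) ≡ b - + 0
    step = solve-∀

  Val⇒∥ : ∀ x → Val x (just m) → m < N → 3^ m ∥ approx x N
  Val⇒∥ x (x≡0 , x≢0) m<N =
    ∣∧∤⇒∥ (≡₃0⇒∣ x x≡0 (ℕₚ.<⇒≤ m<N)) (λ 3ᵐ⁺¹∣xN → x≢0 (∣⇒≡₃0 x 3ᵐ⁺¹∣xN m<N))

  Val⇒∣ : ∀ x → Val x (just m) → j ≤ m → j ≤ N → 3^ j ∣ approx x N
  Val⇒∣ x (x≡0 , _) j≤m = ≡₃0⇒∣ x (∣⇒≡₃0 x (∣-weaken j≤m (≡₃0⇒∣ x x≡0 ℕₚ.≤-refl)) j≤m)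

  Val∞⇒∣ : ∀ x → Val x nothing → j ≤ N → 3^ j ∣ approx x N
  Val∞⇒∣ {N = N} x x≡0 j≤N = ∣-weaken j≤N (≡₃0⇒∣ x (x≡0 N) ℕₚ.≤-refl)

  Val-from-levels : ∀ x N₀ → (∀ N → N₀ ≤ N → 3^ m ∥ approx x N) → Val x (just m)
  Val-from-levels {m} x N₀ x∥ =
    ∣⇒≡₃0 x (∥⇒∣ xN∥) (ℕₚ.<⇒≤ m<N) , λ x≡0 → ∥⇒∤ xN∥ (≡₃0⇒∣ x x≡0 m<N)
    where
    m<N : m < N₀ ℕ.+ suc m
    m<N = ℕₚ.m≤n+m (suc m) N₀
    xN∥ = x∥ (N₀ ℕ.+ suc m) (ℕₚ.m≤m+n N₀ (suc m))

  Val∞-from-levels : ∀ x N₀ → (∀ N → N₀ ≤ N → 3^ N ∣ approx x N) → Val x nothing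
  Val∞-from-levels x N₀ x∣ M =
    ∣⇒≡₃0 x (∣-weaken (ℕₚ.m≤n+m M N₀) (x∣ (N₀ ℕ.+ M) (ℕₚ.m≤m+n N₀ M))) (ℕₚ.m≤n+m M N₀)

  Val-transfer : ∀ x y N₀ {v} → ¬ 3^ 1 ∣ v →
    (∀ N → N₀ ≤ N → Σ ℤ λ u → 3^ n ∥ u × v * approx x N ≡ approx y N * u) →
    Val y w → Val x (w +∞ n)
  Val-transfer {n} {just m} x y N₀ 3∤v factor y-val = Val-from-levels x (N₀ ℕ.+ suc m) xN∥
    where
    xN∥ : ∀ N → N₀ ℕ.+ suc m ≤ N → 3^ (m ℕ.+ n) ∥ approx x N
    xN∥ N le with factor N (ℕₚ.≤-trans (ℕₚ.m≤m+n N₀ (suc m)) le)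
    ... | u , u∥ , eq = ∥-cancelˡ 3∤v (subst (3^ (m ℕ.+ n) ∥_) (sym eq)
                          (∥-* (Val⇒∥ y y-val (ℕₚ.≤-trans (ℕₚ.m≤n+m (suc m) N₀) le)) u∥))
  Val-transfer {w = nothing} x y N₀ 3∤v factor y-val = Val∞-from-levels x N₀ xN∣
    where
    xN∣ : ∀ N → N₀ ≤ N → 3^ N ∣ approx x N
    xN∣ N le with factor N le
    ... | u , _ , eq = ∣-cancelˡ 3∤v (subst (3^ N ∣_) (sym eq) (∣-*ʳ u (Val∞⇒∣ y y-val ℕₚ.≤-refl)))

  Val-resp-≈ : ∀ x y → x ≈₃ y → Val x w → Val y w
  Val-resp-≈ {just m} x y x≈y (x≡0 , x≢0) =
    subst (λ z → pow3 m ℤ∣.∣ z - + 0) (x≈y m) x≡0 ,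
    λ y≡0 → x≢0 (subst (λ z → pow3 (suc m) ℤ∣.∣ z - + 0) (sym (x≈y (suc m))) y≡0)
  Val-resp-≈ {nothing} x y x≈y x≡0 m = subst (λ z → pow3 m ℤ∣.∣ z - + 0) (x≈y m) (x≡0 m)

  ≡₃0-neg : ∀ x → x ≡₃ ι (+ 0) [mod3^ i ] → (-₃ x) ≡₃ ι (+ 0) [mod3^ i ]
  ≡₃0-neg {i} x x≡0 = subst (pow3 i ℤ∣.∣_) (neg-sub (approx x i)) (ℤ∣.∣m⇒∣-m x≡0)
    where
    neg-sub : ∀ a → - (a - + 0) ≡ - a - + 0
    neg-sub = solve-∀

  Val-neg : ∀ x → Val x w → Val (-₃ x) w
  Val-neg {just m} x (x≡0 , x≢0) = ≡₃0-neg x x≡0 , λ -x≡0 → x≢0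
    (subst (λ z → pow3 (suc m) ℤ∣.∣ z - + 0) (ℤₚ.neg-involutive (approx x (suc m))) (≡₃0-neg (-₃ x) -x≡0))
  Val-neg {nothing} x x≡0 m = ≡₃0-neg x (x≡0 m)

  sq+3sq : ℤ₃ → ℤ₃ → ℤ₃
  sq+3sq x y = x *₃ x +₃ nat₃ 3 *₃ (y *₃ y)

  Val-sq+3sq-even : ∀ x y → Val x (just m) → (∀ N → m ≤ N → 3^ m ∣ approx y N) →
                    Val (sq+3sq x y) (just (2 ℕ.* m))
  Val-sq+3sq-even {m} x y x-val y∣ = Val-from-levels (sq+3sq x y) (suc m) λ N m<N →
    subst (3^_∥ approx (sq+3sq x y) N) (cong (m ℕ.+_) (sym (ℕₚ.+-identityʳ m)))
      (∥-sq+3sq-even (Val⇒∥ x x-val m<N) (y∣ N (ℕₚ.<⇒≤ m<N)))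

  Val-sq+3sq-odd : ∀ x y → (∀ N → suc n ≤ N → 3^ suc n ∣ approx x N) → Val y (just n) →
                   Val (sq+3sq x y) (just (2 ℕ.* n ℕ.+ 1))
  Val-sq+3sq-odd {n} x y x∣ y-val = Val-from-levels (sq+3sq x y) (suc n) λ N n<N →
    subst (3^_∥ approx (sq+3sq x y) N) n+n+1≡2n+1 (∥-sq+3sq-odd (x∣ N n<N) (Val⇒∥ y y-val n<N))
    where
    n+n+1≡2n+1 : suc (n ℕ.+ n) ≡ 2 ℕ.* n ℕ.+ 1
    n+n+1≡2n+1 = trans (cong (λ k → suc (n ℕ.+ k)) (sym (ℕₚ.+-identityʳ n))) (ℕₚ.+-comm 1 (2 ℕ.* n))

  Val-sq+3sq : ∀ {a b} x y → Val x a → Val y b → Val (sq+3sq x y) (min∞ (twice a) (twice b +∞ 1))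
  Val-sq+3sq {just m} {just n} x y x-val y-val with m ℕₚ.≤? n
  ... | yes m≤n = subst (λ e → Val (sq+3sq x y) (just e)) (sym (ℕₚ.m≤n⇒m⊓n≡m 2m≤2n+1))
                    (Val-sq+3sq-even x y x-val (λ N m≤N → Val⇒∣ y y-val m≤n m≤N))
    where
    2m≤2n+1 : 2 ℕ.* m ≤ 2 ℕ.* n ℕ.+ 1
    2m≤2n+1 = ℕₚ.≤-trans (ℕₚ.*-monoʳ-≤ 2 m≤n) (ℕₚ.m≤m+n (2 ℕ.* n) 1)
  ... | no m≰n = subst (λ e → Val (sq+3sq x y) (just e)) (sym (ℕₚ.m≥n⇒m⊓n≡n 2n+1≤2m))
                    (Val-sq+3sq-odd x y (λ N n<N → Val⇒∣ x x-val n<m n<N) y-val)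
    where
    n<m = ℕₚ.≰⇒> m≰n
    2n+1≤2m : 2 ℕ.* n ℕ.+ 1 ≤ 2 ℕ.* m
    2n+1≤2m = subst (_≤ 2 ℕ.* m) (ℕₚ.+-comm 1 (2 ℕ.* n)) (ℕₚ.*-monoʳ-< 2 n<m)
  Val-sq+3sq {just m} {nothing} x y x-val y-val =
    Val-sq+3sq-even x y x-val (λ N m≤N → Val∞⇒∣ y y-val m≤N)
  Val-sq+3sq {nothing} {just n} x y x-val y-val =
    Val-sq+3sq-odd x y (λ N n<N → Val∞⇒∣ x x-val n<N) y-val
  Val-sq+3sq {nothing} {nothing} x y x-val y-val = Val∞-from-levels (sq+3sq x y) 0 λ N _ →
    ∣-weaken (ℕₚ.m≤m+n N N) (∣-sq+3sq (Val∞⇒∣ x x-val ℕₚ.≤-refl) (Val∞⇒∣ y y-val ℕₚ.≤-refl))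

module QuadraticRing (B : ℤ) where

  open Valuation
  open FiniteSums
  open import Data.Nat as ℕ using (ℕ; zero; suc; _≤_; _<_; _∸_; z≤n; s≤s)
  import Data.Nat.Properties as ℕₚ
  import Data.Nat.Divisibility as ℕ∣
  open NatFacts
  open import Data.Nat.DivMod using (_/_; m/n≤m)
  open import Data.Nat.Combinatorics using (_C_; k>n⇒nCk≡0; nCk+nC[k+1]≡[n+1]C[k+1])
  open import Data.Integer using (ℤ; +_; _+_; _-_; -_; _*_; _^_)
  import Data.Integer.Properties as ℤₚ
  import Data.Integer.Divisibility.Signed as ℤ∣
  open import Data.Integer.Tactic.RingSolver using (solve; solve-∀)
  open import Data.List using ([]; _∷_)
  open import Data.Product using (Σ; _×_; _,_; proj₁)
  open import Relation.Nullary using (¬_; yes; no)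
  open import Relation.Binary.PropositionalEquality
  open ≡-Reasoning

  data ℤ[√B] : Set where
    ⟨_,_⟩ : ℤ → ℤ → ℤ[√B]

  infixl 7 _⊗_
  infixl 6 _⊕_ _⊖_

  re im : ℤ[√B] → ℤ
  re ⟨ a , _ ⟩ = a
  im ⟨ _ , b ⟩ = b

  _⊗_ _⊕_ _⊖_ : ℤ[√B] → ℤ[√B] → ℤ[√B]
  ⟨ a , b ⟩ ⊗ ⟨ c , d ⟩ = ⟨ a * c + B * (b * d) , a * d + b * c ⟩
  ⟨ a , b ⟩ ⊕ ⟨ c , d ⟩ = ⟨ a + c , b + d ⟩
  ⟨ a , b ⟩ ⊖ ⟨ c , d ⟩ = ⟨ a - c , b - d ⟩

  neg conj : ℤ[√B] → ℤ[√B]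
  neg  ⟨ a , b ⟩ = ⟨ - a , - b ⟩
  conj ⟨ a , b ⟩ = ⟨ a , - b ⟩

  one : ℤ[√B]
  one = ⟨ + 1 , + 0 ⟩

  [_+√B] : ℤ → ℤ[√B]
  [ A +√B] = ⟨ A , + 1 ⟩

  norm : ℤ[√B] → ℤ
  norm ⟨ a , b ⟩ = a * a - B * (b * b)

  pow : ℤ[√B] → ℕ → ℤ[√B]
  pow x zero    = one
  pow x (suc k) = x ⊗ pow x k

  geom : ℤ[√B] → ℕ → ℤ[√B]
  geom x zero    = ⟨ + 0 , + 0 ⟩
  geom x (suc k) = x ⊗ geom x k ⊕ one

  -- The matrix g = (α x; 1 α) has eigenvalues α ± √x, so det (g^k - 1) is the norm of (α + √x)^k - 1.
  t : ℕ → ℤ → ℤ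
  t k A = norm (pow [ A +√B] k ⊖ one)

  ⊗-assoc : ∀ x y z → (x ⊗ y) ⊗ z ≡ x ⊗ (y ⊗ z)
  ⊗-assoc ⟨ a , b ⟩ ⟨ c , d ⟩ ⟨ e , f ⟩ =
    cong₂ ⟨_,_⟩ (solve (a ∷ b ∷ c ∷ d ∷ e ∷ f ∷ B ∷ [])) (solve (a ∷ b ∷ c ∷ d ∷ e ∷ f ∷ B ∷ []))

  ⊗-identityˡ : ∀ x → one ⊗ x ≡ x
  ⊗-identityˡ ⟨ a , b ⟩ = cong₂ ⟨_,_⟩ (solve (a ∷ b ∷ B ∷ [])) (solve (a ∷ b ∷ B ∷ []))

  ⊗-identityʳ : ∀ x → x ⊗ one ≡ x
  ⊗-identityʳ ⟨ a , b ⟩ = cong₂ ⟨_,_⟩ (solve (a ∷ b ∷ B ∷ [])) (solve (a ∷ b ∷ B ∷ []))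

  pow-+ : ∀ x m n → pow x (m ℕ.+ n) ≡ pow x m ⊗ pow x n
  pow-+ x zero    n = sym (⊗-identityˡ (pow x n))
  pow-+ x (suc m) n = trans (cong (x ⊗_) (pow-+ x m n)) (sym (⊗-assoc x (pow x m) (pow x n)))

  pow-* : ∀ x m n → pow x (m ℕ.* n) ≡ pow (pow x m) n
  pow-* x m zero    = cong (pow x) (ℕₚ.*-zeroʳ m)
  pow-* x m (suc n) = begin
    pow x (m ℕ.* suc n)          ≡⟨ cong (pow x) (ℕₚ.*-suc m n) ⟩
    pow x (m ℕ.+ m ℕ.* n)        ≡⟨ pow-+ x m (m ℕ.* n) ⟩
    pow x m ⊗ pow x (m ℕ.* n)    ≡⟨ cong (pow x m ⊗_) (pow-* x m n) ⟩
    pow (pow x m) (suc n)        ∎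

  pow⊖one : ∀ x k → pow x k ⊖ one ≡ (x ⊖ one) ⊗ geom x k
  pow⊖one ⟨ a , b ⟩ zero = cong₂ ⟨_,_⟩ (solve (a ∷ b ∷ B ∷ [])) (solve (a ∷ b ∷ B ∷ []))
  pow⊖one x (suc k) = begin
    x ⊗ pow x k ⊖ one                        ≡⟨ ⊗⊖one x (pow x k) ⟩
    x ⊗ (pow x k ⊖ one) ⊕ (x ⊖ one)          ≡⟨ cong (λ z → x ⊗ z ⊕ (x ⊖ one)) (pow⊖one x k) ⟩
    x ⊗ ((x ⊖ one) ⊗ geom x k) ⊕ (x ⊖ one)   ≡⟨ factor x (geom x k) ⟩
    (x ⊖ one) ⊗ geom x (suc k)               ∎
    where
    ⊗⊖one : ∀ x p → x ⊗ p ⊖ one ≡ x ⊗ (p ⊖ one) ⊕ (x ⊖ one)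
    ⊗⊖one ⟨ a , b ⟩ ⟨ c , d ⟩ = cong₂ ⟨_,_⟩ (solve (a ∷ b ∷ c ∷ d ∷ B ∷ [])) (solve (a ∷ b ∷ c ∷ d ∷ B ∷ []))
    factor : ∀ x g → x ⊗ ((x ⊖ one) ⊗ g) ⊕ (x ⊖ one) ≡ (x ⊖ one) ⊗ (x ⊗ g ⊕ one)
    factor ⟨ a , b ⟩ ⟨ c , d ⟩ = cong₂ ⟨_,_⟩ (solve (a ∷ b ∷ c ∷ d ∷ B ∷ [])) (solve (a ∷ b ∷ c ∷ d ∷ B ∷ []))

  norm-⊗ : ∀ x y → norm (x ⊗ y) ≡ norm x * norm y
  norm-⊗ ⟨ a , b ⟩ ⟨ c , d ⟩ = brahmagupta B a b c d
    where
    brahmagupta : ∀ B a b c d →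
      (a * c + B * (b * d)) * (a * c + B * (b * d)) - B * ((a * d + b * c) * (a * d + b * c))
        ≡ (a * a - B * (b * b)) * (c * c - B * (d * d))
    brahmagupta = solve-∀

  norm-pow⊖one : ∀ x k → norm (pow x k ⊖ one) ≡ norm (x ⊖ one) * norm (geom x k)
  norm-pow⊖one x k = trans (cong norm (pow⊖one x k)) (norm-⊗ (x ⊖ one) (geom x k))

  conj-⊗ : ∀ x y → conj (x ⊗ y) ≡ conj x ⊗ conj y
  conj-⊗ ⟨ a , b ⟩ ⟨ c , d ⟩ = cong₂ ⟨_,_⟩ (solve (a ∷ b ∷ c ∷ d ∷ B ∷ [])) (solve (a ∷ b ∷ c ∷ d ∷ B ∷ []))

  pow-conj : ∀ x k → pow (conj x) k ≡ conj (pow x k)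
  pow-conj x zero    = refl
  pow-conj x (suc k) = trans (cong (conj x ⊗_) (pow-conj x k)) (sym (conj-⊗ x (pow x k)))

  neg-⊗ : ∀ x y → neg x ⊗ y ≡ neg (x ⊗ y)
  neg-⊗ ⟨ a , b ⟩ ⟨ c , d ⟩ = cong₂ ⟨_,_⟩ (solve (a ∷ b ∷ c ∷ d ∷ B ∷ [])) (solve (a ∷ b ∷ c ∷ d ∷ B ∷ []))

  neg-involutive : ∀ x → neg (neg x) ≡ x
  neg-involutive ⟨ a , b ⟩ = cong₂ ⟨_,_⟩ (ℤₚ.neg-involutive a) (ℤₚ.neg-involutive b)

  pow-neg-even : ∀ x j → pow (neg x) (2 ℕ.* j) ≡ pow x (2 ℕ.* j)
  pow-neg-even x j = begin
    pow (neg x) (2 ℕ.* j)   ≡⟨ pow-* (neg x) 2 j ⟩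
    pow (pow (neg x) 2) j   ≡⟨ cong (λ y → pow y j) (square-neg x) ⟩
    pow (pow x 2) j         ≡⟨ pow-* x 2 j ⟨
    pow x (2 ℕ.* j)         ∎
    where
    square-neg : ∀ x → pow (neg x) 2 ≡ pow x 2
    square-neg ⟨ a , b ⟩ = cong₂ ⟨_,_⟩ (solve (a ∷ b ∷ B ∷ [])) (solve (a ∷ b ∷ B ∷ []))

  pow-neg-odd : ∀ x j → pow (neg x) (suc (2 ℕ.* j)) ≡ neg (pow x (suc (2 ℕ.* j)))
  pow-neg-odd x j = trans (cong (neg x ⊗_) (pow-neg-even x j)) (neg-⊗ x (pow x (2 ℕ.* j)))

  norm-conj : ∀ z → norm (conj z) ≡ norm z
  norm-conj ⟨ a , b ⟩ = identity B a b
    where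
    identity : ∀ B a b → a * a - B * (- b * - b) ≡ a * a - B * (b * b)
    identity = solve-∀

  norm-neg : ∀ z → norm (neg z) ≡ norm z
  norm-neg ⟨ a , b ⟩ = identity B a b
    where
    identity : ∀ B a b → - a * - a - B * (- b * - b) ≡ a * a - B * (b * b)
    identity = solve-∀

  t-even-neg : ∀ A j → t (2 ℕ.* j) (- A) ≡ t (2 ℕ.* j) A
  t-even-neg A j = begin
    -- [ - A +√B] reduces to neg (conj [ A +√B]).
    norm (pow (neg (conj ϑ)) (2 ℕ.* j) ⊖ one)  ≡⟨ cong (λ z → norm (z ⊖ one)) (pow-neg-even (conj ϑ) j) ⟩
    norm (pow (conj ϑ) (2 ℕ.* j) ⊖ one)        ≡⟨ cong (λ z → norm (z ⊖ one)) (pow-conj ϑ (2 ℕ.* j)) ⟩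
    norm (conj (pow ϑ (2 ℕ.* j)) ⊖ one)        ≡⟨ cong norm (conj⊖one (pow ϑ (2 ℕ.* j))) ⟩
    norm (conj (pow ϑ (2 ℕ.* j) ⊖ one))        ≡⟨ norm-conj (pow ϑ (2 ℕ.* j) ⊖ one) ⟩
    t (2 ℕ.* j) A                              ∎
    where
    ϑ = [ A +√B]
    conj⊖one : ∀ z → conj z ⊖ one ≡ conj (z ⊖ one)
    conj⊖one ⟨ a , b ⟩ = cong₂ ⟨_,_⟩ refl (solve (b ∷ []))

  t-odd : ∀ A j → t (suc (2 ℕ.* j)) A ≡ norm (pow (neg [ A +√B]) (suc (2 ℕ.* j)) ⊕ one)
  t-odd A j = begin
    norm (pow ϑ k ⊖ one)                       ≡⟨ cong (λ z → norm (pow z k ⊖ one)) (neg-involutive ϑ) ⟨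
    norm (pow (neg (neg ϑ)) k ⊖ one)           ≡⟨ cong (λ z → norm (z ⊖ one)) (pow-neg-odd (neg ϑ) j) ⟩
    norm (neg (pow (neg ϑ) k) ⊖ one)           ≡⟨ cong norm (neg⊖one (pow (neg ϑ) k)) ⟩
    norm (neg (pow (neg ϑ) k ⊕ one))           ≡⟨ norm-neg (pow (neg ϑ) k ⊕ one) ⟩
    norm (pow (neg ϑ) k ⊕ one)                 ∎
    where
    ϑ = [ A +√B]
    k = suc (2 ℕ.* j)
    neg⊖one : ∀ z → neg z ⊖ one ≡ neg (z ⊕ one)
    neg⊖one ⟨ a , b ⟩ = cong₂ ⟨_,_⟩ (solve (a ∷ [])) (solve (b ∷ []))

  -- When 3 ∣ B, (3, √B) is the prime of ℤ[√B] above 3, with residue field 𝔽₃.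
  _≡1[π] : ℤ[√B] → Set
  x ≡1[π] = 3^ 1 ∣ re x - + 1

  _≡1[3] : ℤ[√B] → Set
  x ≡1[3] = x ≡1[π] × 3^ 1 ∣ im x

  re-⊗-sub-one : ∀ a b c d → a * c + B * (b * d) - + 1 ≡ (a - + 1) * c + (c - + 1) + B * (b * d)
  re-⊗-sub-one a b c d = identity B a b c d
    where
    identity : ∀ B a b c d → a * c + B * (b * d) - + 1 ≡ (a - + 1) * c + (c - + 1) + B * (b * d)
    identity = solve-∀

  ≡1[3]-⊗ : ∀ x y → x ≡1[3] → y ≡1[3] → (x ⊗ y) ≡1[3]
  ≡1[3]-⊗ ⟨ a , b ⟩ ⟨ c , d ⟩ (a≡1 , 3∣b) (c≡1 , 3∣d) =
    subst (3^ 1 ∣_) (sym (re-⊗-sub-one a b c d)) (∣-+ (∣-+ (∣-*ʳ c a≡1) c≡1) (∣-*ˡ B (∣-*ʳ d 3∣b))) ,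
    ∣-+ (∣-*ˡ a 3∣d) (∣-*ʳ c 3∣b)

  ≡1[3]-pow : ∀ x → x ≡1[3] → ∀ k → pow x k ≡1[3]
  ≡1[3]-pow x x≡1 zero    = 3^n∣0 1 , 3^n∣0 1
  ≡1[3]-pow x x≡1 (suc k) = ≡1[3]-⊗ x (pow x k) x≡1 (≡1[3]-pow x x≡1 k)

  norm-geom3-∥ : ∀ x → x ≡1[3] → 3^ 2 ∥ norm (geom x 3)
  norm-geom3-∥ ⟨ a , b ⟩ (mk∣ (ℤ∣.divides p a-1≡3p) , mk∣ (ℤ∣.divides q b≡3q)) =
    mk∥ (+ 1 + + 3 * W) (3∤-+ 3∤1 (∣-*ʳ W 3∣3)) (begin
      norm (geom ⟨ a , b ⟩ 3)                      ≡⟨ cong (λ x → norm (geom x 3)) x≡1+3y ⟩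
      norm (geom ⟨ p * + 3 + + 1 , q * + 3 ⟩ 3)    ≡⟨ cong norm (geom-1+3y p q) ⟩
      norm ⟨ + 3 + + 9 * w₁ , + 9 * w₂ ⟩           ≡⟨ norm-3+9w B w₁ w₂ ⟩
      (+ 1 + + 3 * W) * + 9                        ∎)
    where
    w₁ = p + p * p + B * (q * q)
    w₂ = q + + 2 * (p * q)
    W = + 2 * w₁ + + 3 * (w₁ * w₁ - B * (w₂ * w₂))
    x≡1+3y : ⟨ a , b ⟩ ≡ ⟨ p * + 3 + + 1 , q * + 3 ⟩
    x≡1+3y = cong₂ ⟨_,_⟩ (trans (sub-add a) (cong (_+ + 1) a-1≡3p)) b≡3q
      where
      sub-add : ∀ a → a ≡ a - + 1 + + 1
      sub-add = solve-∀
    geom-1+3y : ∀ p q → geom ⟨ p * + 3 + + 1 , q * + 3 ⟩ 3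
                      ≡ ⟨ + 3 + + 9 * (p + p * p + B * (q * q)) , + 9 * (q + + 2 * (p * q)) ⟩
    geom-1+3y p q = cong₂ ⟨_,_⟩ (solve (p ∷ q ∷ B ∷ [])) (solve (p ∷ q ∷ B ∷ []))
    norm-3+9w : ∀ B w₁ w₂ → (+ 3 + + 9 * w₁) * (+ 3 + + 9 * w₁) - B * ((+ 9 * w₂) * (+ 9 * w₂))
                          ≡ (+ 1 + + 3 * (+ 2 * w₁ + + 3 * (w₁ * w₁ - B * (w₂ * w₂)))) * + 9
    norm-3+9w = solve-∀

  cube-tower : ∀ x → x ≡1[3] → ∀ e →
    Σ ℤ λ u → 3^ (2 ℕ.* e) ∥ u × norm (pow x (3 ℕ.^ e) ⊖ one) ≡ norm (x ⊖ one) * u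
  cube-tower x x≡1 zero =
    + 1 , 3∤⇒∥0 3∤1 , trans (cong (λ z → norm (z ⊖ one)) (⊗-identityʳ x)) (sym (ℤₚ.*-identityʳ _))
  cube-tower x x≡1 (suc e) with cube-tower (pow x 3) (≡1[3]-pow x x≡1 3) e
  ... | u , u∥ , eq = norm (geom x 3) * u ,
    subst (3^_∥ norm (geom x 3) * u) (sym (ℕₚ.*-suc 2 e)) (∥-* (norm-geom3-∥ x x≡1) u∥) , (begin
      norm (pow x (3 ℕ.* 3 ℕ.^ e) ⊖ one)           ≡⟨ cong (λ z → norm (z ⊖ one)) (pow-* x 3 (3 ℕ.^ e)) ⟩
      norm (pow (pow x 3) (3 ℕ.^ e) ⊖ one)         ≡⟨ eq ⟩
      norm (pow x 3 ⊖ one) * u                     ≡⟨ cong (_* u) (norm-pow⊖one x 3) ⟩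
      norm (x ⊖ one) * norm (geom x 3) * u         ≡⟨ ℤₚ.*-assoc (norm (x ⊖ one)) (norm (geom x 3)) u ⟩
      norm (x ⊖ one) * (norm (geom x 3) * u)       ∎)

  module _ (3∣B : 3^ 1 ∣ B) where

    ≡1[π]-pow : ∀ x → x ≡1[π] → ∀ k → pow x k ≡1[π]
    ≡1[π]-pow x x≡1 zero    = 3^n∣0 1
    ≡1[π]-pow ⟨ a , b ⟩ a≡1 (suc k) with pow ⟨ a , b ⟩ k | ≡1[π]-pow ⟨ a , b ⟩ a≡1 k
    ... | ⟨ c , d ⟩ | c≡1 =
      subst (3^ 1 ∣_) (sym (re-⊗-sub-one a b c d)) (∣-+ (∣-+ (∣-*ʳ c a≡1) c≡1) (∣-*ʳ (b * d) 3∣B))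

    re-geom : ∀ x → x ≡1[π] → ∀ k → 3^ 1 ∣ re (geom x k) - + k
    re-geom x x≡1 zero = 3^n∣0 1
    re-geom ⟨ a , b ⟩ a≡1 (suc k) with geom ⟨ a , b ⟩ k | re-geom ⟨ a , b ⟩ a≡1 k
    ... | ⟨ c , d ⟩ | c≡k =
      subst (3^ 1 ∣_) (sym (identity B a b c d (+ k))) (∣-+ (∣-+ (∣-*ʳ c a≡1) (∣-*ʳ (b * d) 3∣B)) c≡k)
      where
      identity : ∀ B a b c d k → a * c + B * (b * d) + + 1 - (+ 1 + k) ≡ (a - + 1) * c + B * (b * d) + (c - k)
      identity = solve-∀

    3∤re⇒3∤norm : ∀ z → ¬ 3^ 1 ∣ re z → ¬ 3^ 1 ∣ norm z
    3∤re⇒3∤norm ⟨ a , b ⟩ 3∤a 3∣norm =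
      3∤-* 3∤a 3∤a (subst (3^ 1 ∣_) (identity B a b) (∣-+ 3∣norm (∣-*ʳ (b * b) 3∣B)))
      where
      identity : ∀ B a b → a * a - B * (b * b) + B * (b * b) ≡ a * a
      identity = solve-∀

    norm-geom-3∤ : ∀ x → x ≡1[π] → ∀ {k} → ¬ 3 ℕ∣.∣ k → ¬ 3^ 1 ∣ norm (geom x k)
    norm-geom-3∤ x x≡1 {k} 3∤k = 3∤re⇒3∤norm (geom x k) λ 3∣re →
      3∤k (ℤ∣.∣⇒∣ᵤ (pow3∣ (subst (3^ 1 ∣_) (identity (re (geom x k)) (+ k))
                                  (∣-- 3∣re (re-geom x x≡1 k)))))
      where
      identity : ∀ r k → r - (r - k) ≡ k
      identity = solve-∀

  γ δ : ℤ → ℤ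
  γ A = + 2 * B - + 2 * (A * A) - + 2 * A + + 1
  δ A = + 2 * A + + 1

  3∣γ : 3^ 1 ∣ B → ∀ A → 3^ 1 ∣ A - + 1 → 3^ 1 ∣ γ A
  3∣γ 3∣B A A≡1 = subst (3^ 1 ∣_) (sym (identity B A))
    (∣-- (∣-- (∣-*ˡ (+ 2) 3∣B) (∣-*ˡ (+ 2) (∣-*ʳ (A + + 2) A≡1))) 3∣3)
    where
    identity : ∀ B A → + 2 * B - + 2 * (A * A) - + 2 * A + + 1 ≡ + 2 * B - + 2 * ((A - + 1) * (A + + 2)) - + 3
    identity = solve-∀

  norm-geom-[A+√B]-3 : ∀ A → + 4 * norm (geom [ A +√B] 3) ≡ γ A * γ A + + 3 * (δ A * δ A)
  norm-geom-[A+√B]-3 A = trans (cong (λ z → + 4 * norm z) geom-[A+√B]-3) (identity B A)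
    where
    geom-[A+√B]-3 : geom [ A +√B] 3 ≡ ⟨ A * A + B + A + + 1 , + 2 * A + + 1 ⟩
    geom-[A+√B]-3 = cong₂ ⟨_,_⟩ (solve (A ∷ B ∷ [])) (solve (A ∷ B ∷ []))
    identity : ∀ B A →
      + 4 * ((A * A + B + A + + 1) * (A * A + B + A + + 1) - B * ((+ 2 * A + + 1) * (+ 2 * A + + 1)))
        ≡ (+ 2 * B - + 2 * (A * A) - + 2 * A + + 1) * (+ 2 * B - + 2 * (A * A) - + 2 * A + + 1)
          + + 3 * ((+ 2 * A + + 1) * (+ 2 * A + + 1))
    identity = solve-∀

  norm-[A+√B]⊖one-∥ : 3^ 1 ∥ B → ∀ A → 3^ 1 ∣ A - + 1 → 3^ 1 ∥ norm ([ A +√B] ⊖ one)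
  norm-[A+√B]⊖one-∥ B∥ A A≡1 = ∣-∥ (∣-* A≡1 A≡1) (subst (3^ 1 ∥_) (sym (ℤₚ.*-identityʳ B)) B∥)

  pow-[A+√B]-3≡1[3] : 3^ 1 ∣ B → ∀ A → 3^ 1 ∣ A - + 1 → pow [ A +√B] 3 ≡1[3]
  pow-[A+√B]-3≡1[3] 3∣B A A≡1 = subst _≡1[3] (sym cube) (re≡1 , im≡0)
    where
    cube : pow [ A +√B] 3 ≡ ⟨ A * A * A + + 3 * (A * B) , + 3 * (A * A) + B ⟩
    cube = cong₂ ⟨_,_⟩ (solve (A ∷ B ∷ [])) (solve (A ∷ B ∷ []))
    identity : ∀ A B → A * A * A + + 3 * (A * B) - + 1 ≡ (A - + 1) * (A * A + A + + 1) + + 3 * (A * B)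
    identity = solve-∀
    re≡1 : 3^ 1 ∣ A * A * A + + 3 * (A * B) - + 1
    re≡1 = subst (3^ 1 ∣_) (sym (identity A B)) (∣-+ (∣-*ʳ (A * A + A + + 1) A≡1) (∣-*ʳ (A * B) 3∣3))
    im≡0 : 3^ 1 ∣ + 3 * (A * A) + B
    im≡0 = ∣-+ (∣-*ʳ (A * A) 3∣3) 3∣B

  module _ (B∥ : 3^ 1 ∥ B) (A : ℤ) (A≡1 : 3^ 1 ∣ A - + 1) where

    t-∥-3∤ : ∀ {k} → ¬ 3 ℕ∣.∣ k → 3^ 1 ∥ t k A
    t-∥-3∤ {k} 3∤k = subst (3^ 1 ∥_) (sym (norm-pow⊖one [ A +√B] k))
      (∥-* (norm-[A+√B]⊖one-∥ B∥ A A≡1) (3∤⇒∥0 (norm-geom-3∤ (∥⇒∣ B∥) [ A +√B] A≡1 3∤k)))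

    t-3∣-factor : ∀ {m} → ¬ 3 ℕ∣.∣ m → ∀ e →
      Σ ℤ λ u → 3^ suc (2 ℕ.* e) ∥ u × + 4 * t (3 ℕ.^ suc e ℕ.* m) A ≡ (γ A * γ A + + 3 * (δ A * δ A)) * u
    t-3∣-factor {m} 3∤m e =
      let (u , u∥ , tower) = cube-tower x x≡1 e in
      norm (ϑ ⊖ one) * (u * norm (geom y m)) ,
      subst (3^_∥ norm (ϑ ⊖ one) * (u * norm (geom y m))) (cong suc (ℕₚ.+-identityʳ (2 ℕ.* e)))
        (∥-* (norm-[A+√B]⊖one-∥ B∥ A A≡1) (∥-* u∥ (3∤⇒∥0 (norm-geom-3∤ (∥⇒∣ B∥) y y≡1 3∤m)))) ,
      (begin
        + 4 * t (3 ℕ.^ suc e ℕ.* m) A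
      ≡⟨ cong (λ z → + 4 * norm (z ⊖ one)) pow-ϑ-k ⟩
        + 4 * norm (pow y m ⊖ one)
      ≡⟨ cong (+ 4 *_) (norm-pow⊖one y m) ⟩
        + 4 * (norm (y ⊖ one) * norm (geom y m))
      ≡⟨ cong (λ z → + 4 * (z * norm (geom y m))) tower ⟩
        + 4 * (norm (x ⊖ one) * u * norm (geom y m))
      ≡⟨ cong (λ z → + 4 * (z * u * norm (geom y m))) (norm-pow⊖one ϑ 3) ⟩
        + 4 * (norm (ϑ ⊖ one) * norm (geom ϑ 3) * u * norm (geom y m))
      ≡⟨ regroup (norm (ϑ ⊖ one)) (norm (geom ϑ 3)) u (norm (geom y m)) ⟩
        + 4 * norm (geom ϑ 3) * (norm (ϑ ⊖ one) * (u * norm (geom y m)))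
      ≡⟨ cong (_* (norm (ϑ ⊖ one) * (u * norm (geom y m)))) (norm-geom-[A+√B]-3 A) ⟩
        (γ A * γ A + + 3 * (δ A * δ A)) * (norm (ϑ ⊖ one) * (u * norm (geom y m)))
      ∎)
      where
      ϑ = [ A +√B]
      x = pow ϑ 3
      y = pow x (3 ℕ.^ e)
      x≡1 = pow-[A+√B]-3≡1[3] (∥⇒∣ B∥) A A≡1
      y≡1 = proj₁ (≡1[3]-pow x x≡1 (3 ℕ.^ e))
      pow-ϑ-k : pow ϑ (3 ℕ.^ suc e ℕ.* m) ≡ pow y m
      pow-ϑ-k = trans (pow-* ϑ (3 ℕ.^ suc e) m) (cong (λ z → pow z m) (pow-* ϑ 3 (3 ℕ.^ e)))
      regroup : ∀ a b c d → + 4 * (a * b * c * d) ≡ + 4 * b * (a * (c * d))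
      regroup = solve-∀

  re-⊕ : ∀ x y → re (x ⊕ y) ≡ re x + re y
  re-⊕ ⟨ _ , _ ⟩ ⟨ _ , _ ⟩ = refl

  t-odd-unit : 3^ 1 ∣ B → ∀ A → 3^ 1 ∣ A - + 2 → ∀ j → ¬ 3^ 1 ∣ t (suc (2 ℕ.* j)) A
  t-odd-unit 3∣B A A≡2 j = subst (λ n → ¬ 3^ 1 ∣ n) (sym (t-odd A j)) (3∤re⇒3∤norm 3∣B (y ⊕ one) 3∤re)
    where
    -ϑ≡1 : neg [ A +√B] ≡1[π]
    -ϑ≡1 = subst (3^ 1 ∣_) (identity A) (∣-- (∣-neg A≡2) 3∣3)
      where
      identity : ∀ A → - (A - + 2) - + 3 ≡ - A - + 1
      identity = solve-∀
    y = pow (neg [ A +√B]) (suc (2 ℕ.* j))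
    3∤re : ¬ 3^ 1 ∣ re (y ⊕ one)
    3∤re = subst (λ n → ¬ 3^ 1 ∣ n) (trans (identity (re y)) (sym (re-⊕ y one)))
      (3∤-+ 3∤2 (≡1[π]-pow 3∣B (neg [ A +√B]) -ϑ≡1 (suc (2 ℕ.* j))))
      where
      identity : ∀ r → + 2 + (r - + 1) ≡ r + + 1
      identity = solve-∀

  coeff : ℤ → ℕ → ℕ → ℤ
  coeff A k j = + (k C j) * A ^ (k ∸ j)

  coeff-vanish : ∀ A {k j} → k < j → coeff A k j ≡ + 0
  coeff-vanish A k<j rewrite k>n⇒nCk≡0 k<j = refl

  coeff-zero : ∀ A k → coeff A (suc k) 0 ≡ A * coeff A k 0
  coeff-zero A k = swap A (A ^ k)
    where
    swap : ∀ a p → + 1 * (a * p) ≡ a * (+ 1 * p)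
    swap = solve-∀

  coeff-pascal : ∀ A k j → coeff A (suc k) (suc j) ≡ A * coeff A k (suc j) + coeff A k j
  coeff-pascal A k j = begin
    + (suc k C suc j) * A ^ (k ∸ j)
      ≡⟨ cong (λ c → + c * A ^ (k ∸ j)) (nCk+nC[k+1]≡[n+1]C[k+1] k j) ⟨
    + (k C j ℕ.+ k C suc j) * A ^ (k ∸ j)          ≡⟨ cong (_* A ^ (k ∸ j)) (ℤₚ.pos-+ (k C j) (k C suc j)) ⟩
    (+ (k C j) + + (k C suc j)) * A ^ (k ∸ j)      ≡⟨ ℤₚ.*-distribʳ-+ (A ^ (k ∸ j)) (+ (k C j)) (+ (k C suc j)) ⟩
    coeff A k j + + (k C suc j) * A ^ (k ∸ j)      ≡⟨ cong (λ z → coeff A k j + z) (lower-exponent k j) ⟩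
    coeff A k j + A * coeff A k (suc j)            ≡⟨ ℤₚ.+-comm (coeff A k j) (A * coeff A k (suc j)) ⟩
    A * coeff A k (suc j) + coeff A k j            ∎
    where
    lower-exponent : ∀ k j → + (k C suc j) * A ^ (k ∸ j) ≡ A * coeff A k (suc j)
    lower-exponent k j with suc j ℕₚ.≤? k
    lower-exponent (suc k) j | yes (s≤s j≤k) rewrite ℕₚ.+-∸-assoc 1 j≤k = swap (+ (suc k C suc j)) A (A ^ (k ∸ j))
      where
      swap : ∀ c a p → c * (a * p) ≡ a * (c * p)
      swap = solve-∀
    lower-exponent k j | no j≮k rewrite k>n⇒nCk≡0 (ℕₚ.≰⇒> j≮k) = sym (ℤₚ.*-zeroʳ A)

  reΣ imΣ : ℤ → ℕ → ℕ → ℤ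
  reΣ A M k = Σ≤ M (λ i → coeff A k (2 ℕ.* i) * B ^ i)
  imΣ A M k = Σ≤ M (λ i → coeff A k (suc (2 ℕ.* i)) * B ^ i)

  private
    distrib : ∀ a c c′ p → a * (c * p) + c′ * p ≡ (a * c + c′) * p
    distrib = solve-∀

  imΣ-step : ∀ A M k → A * imΣ A M k + reΣ A M k ≡ imΣ A M (suc k)
  imΣ-step A M k = begin
    A * imΣ A M k + reΣ A M k
      ≡⟨ cong (_+ reΣ A M k) (Σ≤-*ˡ M A _) ⟨
    Σ≤ M (λ i → A * (coeff A k (suc (2 ℕ.* i)) * B ^ i)) + reΣ A M k
      ≡⟨ Σ≤-+ M _ _ ⟨
    Σ≤ M (λ i → A * (coeff A k (suc (2 ℕ.* i)) * B ^ i) + coeff A k (2 ℕ.* i) * B ^ i)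
      ≡⟨ Σ≤-cong M (λ i → trans (distrib A _ _ (B ^ i)) (sym (cong (_* B ^ i) (coeff-pascal A k (2 ℕ.* i))))) ⟩
    imΣ A M (suc k) ∎

  reΣ-step : ∀ A M k → A * reΣ A (suc M) k + B * imΣ A M k ≡ reΣ A (suc M) (suc k)
  reΣ-step A M k = begin
    A * reΣ A (suc M) k + B * imΣ A M k
      ≡⟨ cong (λ r → A * r + B * imΣ A M k) (Σ≤-shift M _) ⟩
    A * (coeff A k 0 * + 1 + Σ≤ M even) + B * imΣ A M k
      ≡⟨ regroup A (coeff A k 0 * + 1) (Σ≤ M even) (B * imΣ A M k) ⟩
    A * (coeff A k 0 * + 1) + (A * Σ≤ M even + B * imΣ A M k)
      ≡⟨ cong₂ (λ u v → u + (v + B * imΣ A M k)) (ℤₚ.*-assoc A (coeff A k 0) (+ 1)) (Σ≤-*ˡ M A even) ⟨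
    A * coeff A k 0 * + 1 + (Σ≤ M (λ i → A * even i) + B * imΣ A M k)
      ≡⟨ cong₂ (λ u v → u * + 1 + (Σ≤ M (λ i → A * even i) + v)) (coeff-zero A k) (Σ≤-*ˡ M B _) ⟨
    coeff A (suc k) 0 * + 1 + (Σ≤ M (λ i → A * even i) + Σ≤ M (λ i → B * (coeff A k (suc (2 ℕ.* i)) * B ^ i)))
      ≡⟨ cong (λ z → coeff A (suc k) 0 * + 1 + z) (Σ≤-+ M _ _) ⟨
    coeff A (suc k) 0 * + 1 + Σ≤ M (λ i → A * even i + B * (coeff A k (suc (2 ℕ.* i)) * B ^ i))
      ≡⟨ cong (λ z → coeff A (suc k) 0 * + 1 + z) (Σ≤-cong M term) ⟩
    coeff A (suc k) 0 * + 1 + Σ≤ M (λ i → coeff A (suc k) (2 ℕ.* suc i) * B ^ suc i)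
      ≡⟨ Σ≤-shift M _ ⟨
    reΣ A (suc M) (suc k) ∎
    where
    even : ℕ → ℤ
    even i = coeff A k (2 ℕ.* suc i) * B ^ suc i
    regroup : ∀ a x y z → a * (x + y) + z ≡ a * x + (a * y + z)
    regroup = solve-∀
    rearrange : ∀ a b c c′ p → a * (c * (b * p)) + b * (c′ * p) ≡ (a * c + c′) * (b * p)
    rearrange = solve-∀
    term : ∀ i → A * even i + B * (coeff A k (suc (2 ℕ.* i)) * B ^ i) ≡ coeff A (suc k) (2 ℕ.* suc i) * B ^ suc i
    term i = begin
      A * even i + B * (coeff A k (suc (2 ℕ.* i)) * B ^ i)
        ≡⟨ cong (λ j → A * (coeff A k j * B ^ suc i) + B * (coeff A k (suc (2 ℕ.* i)) * B ^ i)) (ℕₚ.*-suc 2 i) ⟩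
      A * (coeff A k (suc (suc (2 ℕ.* i))) * (B * B ^ i)) + B * (coeff A k (suc (2 ℕ.* i)) * B ^ i)
        ≡⟨ rearrange A B _ _ (B ^ i) ⟩
      (A * coeff A k (suc (suc (2 ℕ.* i))) + coeff A k (suc (2 ℕ.* i))) * B ^ suc i
        ≡⟨ cong (_* B ^ suc i) (coeff-pascal A k (suc (2 ℕ.* i))) ⟨
      coeff A (suc k) (suc (suc (2 ℕ.* i))) * B ^ suc i
        ≡⟨ cong (λ j → coeff A (suc k) j * B ^ suc i) (ℕₚ.*-suc 2 i) ⟨
      coeff A (suc k) (2 ℕ.* suc i) * B ^ suc i ∎

  pow-expansion : ∀ A k M → k ≤ M → pow [ A +√B] k ≡ ⟨ reΣ A M k , imΣ A M k ⟩
  pow-expansion A zero M _ = cong₂ ⟨_,_⟩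
    (Σ≤-extend (λ i → coeff A 0 (2 ℕ.* i) * B ^ i) {n = M} z≤n λ i 0<i →
      cong (_* B ^ i) (coeff-vanish A (ℕₚ.*-monoʳ-< 2 0<i)))
    (Σ≤-extend (λ i → coeff A 0 (suc (2 ℕ.* i)) * B ^ i) {n = M} z≤n λ i _ →
      cong (_* B ^ i) (coeff-vanish A {j = suc (2 ℕ.* i)} (s≤s z≤n)))
  pow-expansion A (suc k) (suc M) (s≤s k≤M) = begin
    [ A +√B] ⊗ pow [ A +√B] k
      ≡⟨ cong ([ A +√B] ⊗_) (pow-expansion A k (suc M) (ℕₚ.m≤n⇒m≤1+n k≤M)) ⟩
    ⟨ A * reΣ A (suc M) k + B * (+ 1 * imΣ A (suc M) k) , A * imΣ A (suc M) k + + 1 * reΣ A (suc M) k ⟩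
      ≡⟨ cong₂ ⟨_,_⟩ (cong (λ s → A * reΣ A (suc M) k + B * s) (trans (ℤₚ.*-identityˡ _) drop-last))
                     (cong (λ z → A * imΣ A (suc M) k + z) (ℤₚ.*-identityˡ _)) ⟩
    ⟨ A * reΣ A (suc M) k + B * imΣ A M k , A * imΣ A (suc M) k + reΣ A (suc M) k ⟩
      ≡⟨ cong₂ ⟨_,_⟩ (reΣ-step A M k) (imΣ-step A (suc M) k) ⟩
    ⟨ reΣ A (suc M) (suc k) , imΣ A (suc M) (suc k) ⟩ ∎
    where
    drop-last : imΣ A (suc M) k ≡ imΣ A M k
    drop-last = trans (cong (λ z → imΣ A M k + z) (cong (_* B ^ suc M) (coeff-vanish A k<2M+3)))
                      (ℤₚ.+-identityʳ (imΣ A M k))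
      where
      k<2M+3 : k < suc (2 ℕ.* suc M)
      k<2M+3 = s≤s (ℕₚ.≤-trans k≤M (ℕₚ.≤-trans (ℕₚ.n≤1+n M) (ℕₚ.m≤n*m (suc M) 2)))

  re-pow : ∀ A k → re (pow [ A +√B] k) ≡ Σ≤ (k / 2) (λ i → coeff A k (2 ℕ.* i) * B ^ i)
  re-pow A k = trans (cong re (pow-expansion A k k ℕₚ.≤-refl))
    (sym (Σ≤-extend (λ i → coeff A k (2 ℕ.* i) * B ^ i) (m/n≤m k 2) λ i k/2<i →
      cong (_* B ^ i) (coeff-vanish A (half<⇒< k i k/2<i))))

  im-pow : ∀ A j → im (pow [ A +√B] (suc j)) ≡ Σ≤ (j / 2) (λ i → coeff A (suc j) (suc (2 ℕ.* i)) * B ^ i)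
  im-pow A j = trans (cong im (pow-expansion A (suc j) (suc j) ℕₚ.≤-refl))
    (sym (Σ≤-extend (λ i → coeff A (suc j) (suc (2 ℕ.* i)) * B ^ i) (ℕₚ.m≤n⇒m≤1+n (m/n≤m j 2)) λ i j/2<i →
      cong (_* B ^ i) (coeff-vanish A (s≤s (half<⇒< j i j/2<i)))))

  norm⊖one : ∀ z → norm (z ⊖ one) ≡ (re z - + 1) * (re z - + 1) - B * (im z * im z)
  norm⊖one ⟨ a , b ⟩ = identity B a b
    where
    identity : ∀ B a b → (a - + 1) * (a - + 1) - B * ((b - + 0) * (b - + 0)) ≡ (a - + 1) * (a - + 1) - B * (b * b)
    identity = solve-∀


module DetValuation where

  open Valuation
  open ThreeAdicValuation
  open FiniteSums
  open NatFacts
  open import Data.Nat as ℕ using (ℕ; zero; suc; _≤_)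
  import Data.Nat.Properties as ℕₚ
  import Data.Nat.Divisibility as ℕ∣
  open import Data.Nat.DivMod using (_/_)
  open import Data.Nat.Combinatorics using (_C_)
  open import Data.Nat.GCD using (gcd; gcd[m,n]∣m; gcd-greatest)
  open import Data.Integer using (ℤ; +_; _+_; _-_; -_; _*_; _^_)
  import Data.Integer.Properties as ℤₚ
  open import Data.Integer.Tactic.RingSolver using (solve-∀)
  open import Data.Maybe using (just; nothing)
  open import Data.Product using (Σ; _×_; _,_; proj₁)
  open import Data.Empty using (⊥-elim)
  open import Relation.Nullary using (¬_)
  open import Relation.Binary.PropositionalEquality
  open ≡-Reasoning

  approx-^₃ : ∀ x j N → approx (x ^₃ j) N ≡ approx x N ^ j
  approx-^₃ x zero    N = refl
  approx-^₃ x (suc j) N = cong (approx x N *_) (approx-^₃ x j N)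

  approx-sum₃ : ∀ M f N → approx (sum₃ M f) N ≡ Σ≤ M (λ i → approx (f i) N)
  approx-sum₃ zero    f N = refl
  approx-sum₃ (suc M) f N = cong (_+ approx (f (suc M)) N) (approx-sum₃ M f N)

  module _ (α β : ℤ₃) (N : ℕ) where

    open QuadraticRing (approx β N)

    approx-r0 : ∀ k → approx (r0 k α β) N ≡ re (pow [ approx α N +√B] k)
    approx-r0 k = begin
      approx (r0 k α β) N
        ≡⟨ approx-sum₃ (k / 2) _ N ⟩
      Σ≤ (k / 2) (λ i → approx (nat₃ (k C (2 ℕ.* i)) *₃ α ^₃ (k ℕ.∸ 2 ℕ.* i) *₃ β ^₃ i) N)
        ≡⟨ Σ≤-cong (k / 2) (λ i → cong₂ (λ a b → + (k C (2 ℕ.* i)) * a * b)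
                                         (approx-^₃ α (k ℕ.∸ 2 ℕ.* i) N) (approx-^₃ β i N)) ⟩
      Σ≤ (k / 2) (λ i → coeff (approx α N) k (2 ℕ.* i) * approx β N ^ i)
        ≡⟨ re-pow (approx α N) k ⟨
      re (pow [ approx α N +√B] k) ∎

    approx-s0 : ∀ k → approx (s0 k α β) N ≡ im (pow [ approx α N +√B] k)
    approx-s0 zero    = refl
    approx-s0 (suc j) = begin
      approx (s0 (suc j) α β) N
        ≡⟨ approx-sum₃ (j / 2) _ N ⟩
      Σ≤ (j / 2) (λ i → approx (nat₃ (suc j C (2 ℕ.* i ℕ.+ 1)) *₃ α ^₃ (suc j ℕ.∸ 2 ℕ.* i ℕ.∸ 1) *₃ β ^₃ i) N)
        ≡⟨ Σ≤-cong (j / 2) term ⟩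
      Σ≤ (j / 2) (λ i → coeff (approx α N) (suc j) (suc (2 ℕ.* i)) * approx β N ^ i)
        ≡⟨ im-pow (approx α N) j ⟨
      im (pow [ approx α N +√B] (suc j)) ∎
      where
      term : ∀ i → approx (nat₃ (suc j C (2 ℕ.* i ℕ.+ 1)) *₃ α ^₃ (suc j ℕ.∸ 2 ℕ.* i ℕ.∸ 1) *₃ β ^₃ i) N
                 ≡ coeff (approx α N) (suc j) (suc (2 ℕ.* i)) * approx β N ^ i
      term i rewrite approx-^₃ α (suc j ℕ.∸ 2 ℕ.* i ℕ.∸ 1) N | approx-^₃ β i N
                   | ℕₚ.∸-+-assoc (suc j) (2 ℕ.* i) 1 | ℕₚ.+-comm (2 ℕ.* i) 1 = refl

    approx-t0 : ∀ k → approx (t0 k α β) N ≡ t k (approx α N)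
    approx-t0 k = begin
      approx (t0 k α β) N
        ≡⟨ shape (approx β N) (approx (r0 k α β) N) (approx (s0 k α β) N) ⟩
      (approx (r0 k α β) N - + 1) * (approx (r0 k α β) N - + 1)
        - approx β N * (approx (s0 k α β) N * approx (s0 k α β) N)
        ≡⟨ cong₂ (λ r s → (r - + 1) * (r - + 1) - approx β N * (s * s)) (approx-r0 k) (approx-s0 k) ⟩
      (re ϑᵏ - + 1) * (re ϑᵏ - + 1) - approx β N * (im ϑᵏ * im ϑᵏ)
        ≡⟨ norm⊖one ϑᵏ ⟨
      t k (approx α N) ∎
      where
      ϑᵏ = pow [ approx α N +√B] k
      shape : ∀ B r s → (r - + 1) * ((r - + 1) * + 1) - B * (s * (s * + 1)) ≡ (r - + 1) * (r - + 1) - B * (s * s)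
      shape = solve-∀

  γ₃ : ℤ₃ → ℤ₃ → ℤ₃
  γ₃ α β = nat₃ 2 *₃ β -₃ nat₃ 2 *₃ α ^₃ 2 -₃ nat₃ 2 *₃ α +₃ nat₃ 1

  δ₃ : ℤ₃ → ℤ₃
  δ₃ α = nat₃ 2 *₃ α +₃ nat₃ 1

  approx-γ₃ : ∀ α β N → approx (γ₃ α β) N ≡ QuadraticRing.γ (approx β N) (approx α N)
  approx-γ₃ α β N = identity (approx β N) (approx α N)
    where
    identity : ∀ B A → + 2 * B + - (+ 2 * (A * (A * + 1))) + - (+ 2 * A) + + 1 ≡ + 2 * B - + 2 * (A * A) - + 2 * A + + 1
    identity = solve-∀

  approx-δ₃ : ∀ α β N → approx (δ₃ α) N ≡ QuadraticRing.δ (approx β N) (approx α N)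
  approx-δ₃ α β N = refl

  approx-sq+3sq : ∀ α β N → let open QuadraticRing (approx β N) in
      approx (sq+3sq (γ₃ α β) (δ₃ α)) N
        ≡ γ (approx α N) * γ (approx α N) + + 3 * (δ (approx α N) * δ (approx α N))
  approx-sq+3sq α β N = cong₂ (λ g d → g * g + + 3 * (d * d)) (approx-γ₃ α β N) (approx-δ₃ α β N)

  3∤4 : ¬ 3^ 1 ∣ + 4
  3∤4 = 3∤-+ 3∤1 3∣3

  module _ (α β : ℤ₃) (β-val : Val β (just 1)) where

    private
      B∥ : ∀ {N} → 2 ≤ N → 3^ 1 ∥ approx β N
      B∥ = Val⇒∥ β β-val

    module _ (α≡1 : α ≡₃ ι (+ 1) [mod3^ 1 ]) where

      private
        A≡1 : ∀ {N} → 2 ≤ N → 3^ 1 ∣ approx α N - + 1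
        A≡1 2≤N = ≡₃-lift α (+ 1) α≡1 (ℕₚ.<⇒≤ 2≤N)

      t0-val-3∤ : ∀ {k} → ¬ 3 ℕ∣.∣ k → Val (t0 k α β) (just 1)
      t0-val-3∤ {k} 3∤k = Val-from-levels (t0 k α β) 2 λ N 2≤N →
        subst (3^ 1 ∥_) (sym (approx-t0 α β N k))
          (QuadraticRing.t-∥-3∤ (approx β N) (B∥ 2≤N) (approx α N) (A≡1 2≤N) 3∤k)

      t0-val-3∣ : ∀ {m} → ¬ 3 ℕ∣.∣ m → ∀ e {w} → Val (sq+3sq (γ₃ α β) (δ₃ α)) w →
                  Val (t0 (3 ℕ.^ suc e ℕ.* m) α β) (w +∞ suc (2 ℕ.* e))
      t0-val-3∣ {m} 3∤m e = Val-transfer (t0 (3 ℕ.^ suc e ℕ.* m) α β) (sq+3sq (γ₃ α β) (δ₃ α)) 2 3∤4 factor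
        where
        factor : ∀ N → 2 ≤ N → Σ ℤ λ u → 3^ suc (2 ℕ.* e) ∥ u ×
                 + 4 * approx (t0 (3 ℕ.^ suc e ℕ.* m) α β) N ≡ approx (sq+3sq (γ₃ α β) (δ₃ α)) N * u
        factor N 2≤N = transport (QuadraticRing.t-3∣-factor (approx β N) (B∥ 2≤N) (approx α N) (A≡1 2≤N) 3∤m e)
          where
          transport : (let open QuadraticRing (approx β N) in
                       Σ ℤ λ u → 3^ suc (2 ℕ.* e) ∥ u ×
                         + 4 * t (3 ℕ.^ suc e ℕ.* m) (approx α N)
                           ≡ (γ (approx α N) * γ (approx α N) + + 3 * (δ (approx α N) * δ (approx α N))) * u) →
                      Σ ℤ λ u → 3^ suc (2 ℕ.* e) ∥ u ×
                        + 4 * approx (t0 (3 ℕ.^ suc e ℕ.* m) α β) N ≡ approx (sq+3sq (γ₃ α β) (δ₃ α)) N * u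
          transport (u , u∥ , 4t≡) =
            u , u∥ , trans (cong (+ 4 *_) (approx-t0 α β N (3 ℕ.^ suc e ℕ.* m)))
                           (trans 4t≡ (cong (_* u) (sym (approx-sq+3sq α β N))))

      γ₃-val≢0 : ∀ {a} → Val (γ₃ α β) a → a ≢ just 0
      γ₃-val≢0 {just zero}    (_ , γ₁≢0) refl =
        γ₁≢0 (pow3∣ (subst (3^ 1 ∣_) (sym (ℤₚ.+-identityʳ _)) 3∣γ₁))
        where
        3∣γ₁ : 3^ 1 ∣ approx (γ₃ α β) 1
        3∣γ₁ = subst (3^ 1 ∣_) (sym (approx-γ₃ α β 1))
          (QuadraticRing.3∣γ (approx β 1) (≡₃0⇒∣ β (proj₁ β-val) ℕₚ.≤-refl) (approx α 1) (mk∣ α≡1))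
      γ₃-val≢0 {just (suc _)} _ ()
      γ₃-val≢0 {nothing}      _ ()

      t0-val-Val3ℕ : ∀ {k} → 3 ℕ∣.∣ k → ∀ e a b → Val3ℕ k e → Val (γ₃ α β) a → Val (δ₃ α) b →
                     Val (t0 k α β) (min∞ (twiceMinusOne a) (twice b) +∞ (2 ℕ.* e))
      t0-val-Val3ℕ 3∣k zero    a b (_ , 3∤k) γ-val δ-val = ⊥-elim (3∤k 3∣k)
      t0-val-Val3ℕ {k} 3∣k (suc e) a b k-val γ-val δ-val = from-split (Val3ℕ⇒ {e = suc e} k-val)
        where
        from-split : (Σ ℕ λ m → k ≡ 3 ℕ.^ suc e ℕ.* m × ¬ 3 ℕ∣.∣ m) →
                     Val (t0 k α β) (min∞ (twiceMinusOne a) (twice b) +∞ (2 ℕ.* suc e))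
        from-split (m , k≡ , 3∤m) =
          subst₂ (λ n w → Val (t0 n α β) w) (sym k≡) (min∞-shift b e (γ₃-val≢0 γ-val))
            (t0-val-3∣ 3∤m e (Val-sq+3sq (γ₃ α β) (δ₃ α) γ-val δ-val))

    t0-val-odd : α ≡₃ ι (+ 2) [mod3^ 1 ] → ∀ {k} → ¬ 2 ℕ∣.∣ k → Val (t0 k α β) (just 0)
    t0-val-odd α≡2 {k} 2∤k = from-odd (¬2∣⇒odd k 2∤k)
      where
      from-odd : (Σ ℕ λ j → k ≡ suc (2 ℕ.* j)) → Val (t0 k α β) (just 0)
      from-odd (j , k≡) = subst (λ n → Val (t0 n α β) (just 0)) (sym k≡)
        (Val-from-levels (t0 (suc (2 ℕ.* j)) α β) 2 λ N 2≤N →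
          subst (3^ 0 ∥_) (sym (approx-t0 α β N (suc (2 ℕ.* j))))
            (3∤⇒∥0 (QuadraticRing.t-odd-unit (approx β N) (∥⇒∣ (B∥ 2≤N)) (approx α N)
                      (≡₃-lift α (+ 2) α≡2 (ℕₚ.<⇒≤ 2≤N)) j)))

  t0-even-neg : ∀ α β {k} → 2 ℕ∣.∣ k → t0 k (-₃ α) β ≈₃ t0 k α β
  t0-even-neg α β {k} (ℕ∣.divides j refl) N = begin
    approx (t0 k (-₃ α) β) N  ≡⟨ approx-t0 (-₃ α) β N k ⟩
    t k (- A)                 ≡⟨ cong (λ n → t n (- A)) (ℕₚ.*-comm j 2) ⟩
    t (2 ℕ.* j) (- A)         ≡⟨ t-even-neg A j ⟩
    t (2 ℕ.* j) A             ≡⟨ cong (λ n → t n A) (ℕₚ.*-comm 2 j) ⟩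
    t k A                     ≡⟨ approx-t0 α β N k ⟨
    approx (t0 k α β) N       ∎
    where
    open QuadraticRing (approx β N)
    A = approx α N

  -₃≡1 : ∀ α → α ≡₃ ι (+ 2) [mod3^ 1 ] → (-₃ α) ≡₃ ι (+ 1) [mod3^ 1 ]
  -₃≡1 α α≡2 = pow3∣ (subst (3^ 1 ∣_) (identity (approx α 1)) (∣-- (∣-neg (mk∣ α≡2)) 3∣3))
    where
    identity : ∀ A → - (A - + 2) - + 3 ≡ - A - + 1
    identity = solve-∀

  module _ (α β : ℤ₃) (β-val : Val β (just 1)) (α≡2 : α ≡₃ ι (+ 2) [mod3^ 1 ]) where

    t0-val-gcd : ∀ {k} → gcd k 6 ≡ 2 → Val (t0 k α β) (just 1)
    t0-val-gcd {k} gcd≡2 = Val-resp-≈ (t0 k (-₃ α) β) (t0 k α β) (t0-even-neg α β 2∣k)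
      (t0-val-3∤ (-₃ α) β β-val (-₃≡1 α α≡2) 3∤k)
      where
      2∣k : 2 ℕ∣.∣ k
      2∣k = subst (ℕ∣._∣ k) gcd≡2 (gcd[m,n]∣m k 6)
      3∤k : ¬ 3 ℕ∣.∣ k
      3∤k 3∣k with ℕ∣.∣⇒≤ (subst (3 ℕ∣.∣_) gcd≡2 (gcd-greatest 3∣k (ℕ∣.divides 2 refl)))
      ... | ℕ.s≤s (ℕ.s≤s ())

    t0-val-6∣ : ∀ {k} → 6 ℕ∣.∣ k → ∀ e a b → Val3ℕ k e
      → Val (nat₃ 2 *₃ β -₃ nat₃ 2 *₃ α ^₃ 2 +₃ nat₃ 2 *₃ α +₃ nat₃ 1) a
      → Val (nat₃ 2 *₃ α -₃ nat₃ 1) b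
      → Val (t0 k α β) (min∞ (twiceMinusOne a) (twice b) +∞ (2 ℕ.* e))
    t0-val-6∣ {k} 6∣k e a b k-val c-val d-val =
      Val-resp-≈ (t0 k (-₃ α) β) (t0 k α β) (t0-even-neg α β (ℕ∣.∣-trans (ℕ∣.divides 3 refl) 6∣k))
        (t0-val-Val3ℕ (-₃ α) β β-val (-₃≡1 α α≡2) (ℕ∣.∣-trans (ℕ∣.divides 2 refl) 6∣k) e a b k-val
          (Val-resp-≈ (nat₃ 2 *₃ β -₃ nat₃ 2 *₃ α ^₃ 2 +₃ nat₃ 2 *₃ α +₃ nat₃ 1) (γ₃ (-₃ α) β)
                      (λ N → γ-even (approx β N) (approx α N)) c-val)
          (Val-resp-≈ (-₃ (nat₃ 2 *₃ α -₃ nat₃ 1)) (δ₃ (-₃ α))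
                      (λ N → δ-odd (approx α N)) (Val-neg (nat₃ 2 *₃ α -₃ nat₃ 1) d-val)))
      where
      γ-even : ∀ B A → + 2 * B + - (+ 2 * (A * (A * + 1))) + + 2 * A + + 1
                     ≡ + 2 * B + - (+ 2 * (- A * (- A * + 1))) + - (+ 2 * - A) + + 1
      γ-even = solve-∀
      δ-odd : ∀ A → - (+ 2 * A + - (+ 1)) ≡ + 2 * - A + + 1
      δ-odd = solve-∀

open import Data.Nat using (ℕ; _≤_; _*_)
open import Data.Nat.Divisibility using (_∣_)
open import Data.Nat.GCD using (gcd)
open import Data.Integer using (+_)
open import Data.Maybe using (just)
open import Data.Product using (_×_; _,_)
open import Relation.Nullary using (¬_)
open import Relation.Binary.PropositionalEquality using (_≡_)
open DetValuation

-- Neither α ≢ 0 (mod 3) nor k ≥ 1 is needed: each case fixes α mod 3, and k = 0 meets no case's hypotheses.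
lemma5p11 : (α β : ℤ₃) → ¬ (α ≡₃ ι (+ 0) [mod3^ 1 ]) → Val β (just 1) → (k : ℕ) → 1 ≤ k →
    ((α ≡₃ ι (+ 1) [mod3^ 1 ] →
        (¬ (3 ∣ k) → Val (t0 k α β) (just 1))
      × (3 ∣ k → ∀ e a b → Val3ℕ k e
           → Val (nat₃ 2 *₃ β -₃ nat₃ 2 *₃ α ^₃ 2 -₃ nat₃ 2 *₃ α +₃ nat₃ 1) a
           → Val (nat₃ 2 *₃ α +₃ nat₃ 1) b
           → Val (t0 k α β) (min∞ (twiceMinusOne a) (twice b) +∞ (2 * e))))
    × (α ≡₃ ι (+ 2) [mod3^ 1 ] →
        (¬ (2 ∣ k) → Val (t0 k α β) (just 0))
      × (gcd k 6 ≡ 2 → Val (t0 k α β) (just 1))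
      × (6 ∣ k → ∀ e a b → Val3ℕ k e
           → Val (nat₃ 2 *₃ β -₃ nat₃ 2 *₃ α ^₃ 2 +₃ nat₃ 2 *₃ α +₃ nat₃ 1) a
           → Val (nat₃ 2 *₃ α -₃ nat₃ 1) b
           → Val (t0 k α β) (min∞ (twiceMinusOne a) (twice b) +∞ (2 * e)))))
lemma5p11 α β _ β-val k _ =
    (λ α≡1 → t0-val-3∤ α β β-val α≡1 {k} , t0-val-Val3ℕ α β β-val α≡1 {k})
  , (λ α≡2 → t0-val-odd α β β-val α≡2 {k} , t0-val-gcd α β β-val α≡2 {k} , t0-val-6∣ α β β-val α≡2 {k})
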